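{- Let $n\geq 0$ and $k\geq 1$ be integers. Define $\varepsilon_1(n)=(-1)^{T_m}$, $\varepsilon_2(n)=(-1)^{T_{\lfloor m/2\rfloor}}$, $\varepsilon_3(n)=1$ if $n=G_m$ for some (necessarily unique) integer $m\geq 0$, and $\varepsilon_1(n)=\varepsilon_2(n)=\varepsilon_3(n)=0$ if $n$ is not a generalized pentagonal number. Then: (a) $(-1)^{k}\left( Q(n)+2 \sum_{j=1}^{k} (-1)^j Q(n-j^2)-\varepsilon_1(n)\right) \geq 0$, with strict inequality if and only if $n\geq (k+1)^2$; (b) $(-1)^{k}\left( Q(n)+2 \sum_{j=1}^{k} (-1)^j Q(n-2j^2)-\varepsilon_2(n)\right) \geq 0$, with strict inequality if and only if $n\geq 2(k+1)^2$; (c) $(-1)^{k}\left( Q(n)+2 \sum_{j=1}^{k} (-1)^j Q(n-3j^2)-\varepsilon_3(n)\right) \geq 0$, with strict inequality if and only if $n\geq 3(k+1)^2$.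
   Context: $Q(n)$ denotes the number of partitions of $n$ into distinct parts, with $Q(0)=1$ and $Q(n)=0$ for negative $n$. For a nonnegative integer $n$, $T_n=n(n+1)/2$ and $G_n=T_n-T_{\lfloor n/2\rfloor}$ is the $n$th generalized pentagonal number; the numbers $G_0,G_1,G_2,\dots$ are pairwise distinct. -}

module Defs where

open import Data.Nat as ℕ using (ℕ; zero; suc; _∸_; _≤?_; _≟_)
open import Data.Nat.DivMod using (_/_)
open import Data.Integer as ℤ using (ℤ; +_; -[1+_]; _^_)
open import Data.Maybe using (Maybe; just; nothing)
open import Relation.Nullary using (yes; no)

-- D n m = number of partitions of n into distinct parts, all parts ≤ m
-- (either the largest allowed part m+1 is not used, or it is used once).
D : ℕ → ℕ → ℕ
D zero    zero    = 1
D (suc n) zero    = 0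
D n       (suc m) with suc m ≤? n
... | yes _ = D n m ℕ.+ D (n ∸ suc m) m
... | no  _ = D n m

Q : ℕ → ℕ
Q n = D n n

Qℤ : ℤ → ℕ
Qℤ (+ n)    = Q n
Qℤ -[1+ n ] = 0

T : ℕ → ℕ
T n = (n ℕ.* suc n) / 2

G : ℕ → ℕ
G n = T n ∸ T (n / 2)

findIndexUpTo : ℕ → ℕ → Maybe ℕ
findIndexUpTo n zero with G zero ≟ n
... | yes _ = just zero
... | no  _ = nothing
findIndexUpTo n (suc b) with findIndexUpTo n b
... | just m  = just m
... | nothing with G (suc b) ≟ n
...   | yes _ = just (suc b)
...   | no  _ = nothing

-- pentIndex n = just m iff n = G m (m is unique since the G's are distinct,
-- and necessarily m ≤ n since G m ≥ m); nothing if n is not a generalized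
-- pentagonal number
pentIndex : ℕ → Maybe ℕ
pentIndex n = findIndexUpTo n n

-1ℤ : ℤ
-1ℤ = -[1+ 0 ]

ε₁ : ℕ → ℤ
ε₁ n with pentIndex n
... | just m  = -1ℤ ^ T m
... | nothing = + 0

ε₂ : ℕ → ℤ
ε₂ n with pentIndex n
... | just m  = -1ℤ ^ T (m / 2)
... | nothing = + 0

ε₃ : ℕ → ℤ
ε₃ n with pentIndex n
... | just m  = + 1
... | nothing = + 0

Σ₁ : ℕ → (ℕ → ℤ) → ℤ
Σ₁ zero    f = + 0
Σ₁ (suc k) f = Σ₁ k f ℤ.+ f (suc k)

expr : ℕ → (ℕ → ℤ) → ℕ → ℕ → ℤ
expr c ε n k =
  (-1ℤ ^ k) ℤ.* ( (+ Q n)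
                  ℤ.+ (+ 2) ℤ.* Σ₁ k (λ j → (-1ℤ ^ j) ℤ.* (+ Qℤ ((+ n) ℤ.- (+ (c ℕ.* (j ℕ.* j))))))
                  ℤ.- ε n )

{-# OPTIONS --safe #-}

-- Work in ℤ[[q]], with identities between truncated series checked modulo q^M. The finite
-- q-binomial theorem yields a finite Jacobi triple product; together with Euler's identity
-- (-q; q)(q; q²) = 1 and 2- and 3-dissections of (q; q) it gives, for c = 1, 2, 3,
--   (-q; q)_∞ · Σ_{j ∈ ℤ} (-1)^j q^(c j²) = Σ_m ε_c(G_m) q^(G_m)
-- (for c = 2 after q ↦ -q). Comparing coefficients of q^n,
--   Q(n) + 2 Σ_{j ≥ 1} (-1)^j Q(n - c j²) = ε_c(n),
-- so the expression of the theorem equals 2 Σ_{t ≥ 0} (-1)^t Q(n - c (k+1+t)²). This is an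
-- alternating sum of non-increasing terms, hence non-negative, and positive exactly when its
-- first term exceeds its second; since Q(x) < Q(x + 3), that happens iff n ≥ c (k+1)².

module Submission where

open import Defs
open import Algebra.Bundles using (CommutativeMonoid; CommutativeRing)
import Algebra.Properties.CommutativeSemigroup as CommutativeSemigroupProperties
open import Algebra.Structures using (IsCommutativeRing)
import Algebra.Solver.Ring
open import Algebra.Solver.Ring.AlmostCommutativeRing using (fromCommutativeRing; _-Raw-AlmostCommutative⟶_)
open import Data.Integer as ℤ using (ℤ; +_)
import Data.Integer.Properties as ℤ
open import Data.Maybe using (Maybe; just; nothing)
open import Data.Nat as ℕ using (ℕ; zero; suc; z≤n; s≤s; _∸_)
import Data.Nat.Properties as ℕ
open import Data.Empty using (⊥-elim)
open import Data.Product using (_×_; _,_; proj₁; proj₂)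
open import Data.Sum using (inj₁; inj₂)
open import Function using (_∘_)
open import Level using (0ℓ)
open import Relation.Binary.PropositionalEquality as ≡
  using (_≡_; _≢_; _≗_; refl; cong; cong₂)
open import Relation.Binary.Bundles using (Setoid)
import Relation.Binary.Reasoning.Setoid as SetoidReasoning
open import Relation.Nullary using (yes; no)

module BigOperator (M : CommutativeMonoid 0ℓ 0ℓ) where

  open import Data.Nat using (_<_)
  open CommutativeMonoid M renaming (refl to ≈-refl)
  open CommutativeSemigroupProperties commutativeSemigroup using (interchange)
  open SetoidReasoning setoid

  big : ℕ → (ℕ → Carrier) → Carrier
  big zero    f = ε
  big (suc n) f = f 0 ∙ big n (f ∘ suc)

  big-cong : ∀ n {f g} → (∀ i → i < n → f i ≈ g i) → big n f ≈ big n g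
  big-cong zero    f≈g = ≈-refl
  big-cong (suc n) f≈g = ∙-cong (f≈g 0 (s≤s z≤n)) (big-cong n (λ i i<n → f≈g (suc i) (s≤s i<n)))

  big-ε : ∀ n → big n (λ _ → ε) ≈ ε
  big-ε zero    = ≈-refl
  big-ε (suc n) = trans (identityˡ _) (big-ε n)

  big-+ : ∀ m n f → big (m ℕ.+ n) f ≈ big m f ∙ big n (f ∘ (m ℕ.+_))
  big-+ zero    n f = sym (identityˡ _)
  big-+ (suc m) n f = trans (∙-congˡ (big-+ m n (f ∘ suc))) (sym (assoc _ _ _))

  big-suc-last : ∀ n f → big (suc n) f ≈ big n f ∙ f n
  big-suc-last zero    f = comm (f 0) ε
  big-suc-last (suc n) f = trans (∙-congˡ (big-suc-last n (f ∘ suc))) (sym (assoc _ _ _))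

  big-∙ : ∀ n f g → big n (λ i → f i ∙ g i) ≈ big n f ∙ big n g
  big-∙ zero    f g = sym (identityˡ ε)
  big-∙ (suc n) f g =
    trans (∙-congˡ (big-∙ n (f ∘ suc) (g ∘ suc))) (interchange (f 0) (g 0) _ _)

  big-swap : ∀ m n (g : ℕ → ℕ → Carrier) →
             big m (λ i → big n (g i)) ≈ big n (λ j → big m (λ i → g i j))
  big-swap zero    n g = sym (big-ε n)
  big-swap (suc m) n g = begin
      big n (g 0) ∙ big m (λ i → big n (g (suc i)))
    ≈⟨ ∙-congˡ (big-swap m n (g ∘ suc)) ⟩
      big n (g 0) ∙ big n (λ j → big m (λ i → g (suc i) j))
    ≈⟨ big-∙ n (g 0) _ ⟨
      big n (λ j → big (suc m) (λ i → g i j))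
    ∎

  big-blocks : ∀ m r f → big (m ℕ.* r) f ≈ big m (λ i → big r (λ j → f (i ℕ.* r ℕ.+ j)))
  big-blocks zero    r f = ≈-refl
  big-blocks (suc m) r f = begin
      big (r ℕ.+ m ℕ.* r) f
    ≈⟨ big-+ r (m ℕ.* r) f ⟩
      big r f ∙ big (m ℕ.* r) (f ∘ (r ℕ.+_))
    ≈⟨ ∙-congˡ (big-blocks m r (f ∘ (r ℕ.+_))) ⟩
      big r f ∙ big m (λ i → big r (λ j → f (r ℕ.+ (i ℕ.* r ℕ.+ j))))
    ≈⟨ ∙-congˡ (big-cong m λ i _ → big-cong r λ j _ → reflexive (cong f (ℕ.+-assoc r (i ℕ.* r) j))) ⟨
      big (suc m) (λ i → big r (λ j → f (i ℕ.* r ℕ.+ j)))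
    ∎

  big-reverse : ∀ n f → big n f ≈ big n (λ j → f (n ∸ suc j))
  big-reverse zero    f = ≈-refl
  big-reverse (suc n) f = begin
    f 0 ∙ big n (f ∘ suc)                    ≈⟨ ∙-congˡ (big-reverse n (f ∘ suc)) ⟩
    f 0 ∙ big n (λ j → f (suc (n ∸ suc j)))  ≈⟨ ∙-congˡ (big-cong n λ j j<n → reflexive (cong f (ℕ.+-∸-assoc 1 j<n))) ⟨
    f 0 ∙ big n (λ j → f (n ∸ j))            ≈⟨ comm _ _ ⟩
    big n (λ j → f (n ∸ j)) ∙ f 0            ≈⟨ ∙-congˡ (reflexive (cong f (ℕ.n∸n≡0 n))) ⟨
    big n (λ j → f (n ∸ j)) ∙ f (n ∸ n)      ≈⟨ big-suc-last n (λ j → f (suc n ∸ suc j)) ⟨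
    big (suc n) (λ j → f (suc n ∸ suc j))    ∎

module Series where

  open import Data.Integer using (_+_; _-_; _*_; -_)
  open import Data.Integer.Tactic.RingSolver using (solve-∀)

  Series : Set
  Series = ℕ → ℤ

  -- A record rather than f ≗ g, so that f and g can be inferred from f ≈ g.
  infix 4 _≈_
  record _≈_ (f g : Series) : Set where
    constructor mk≈
    field at : f ≗ g
  open _≈_ public

  0ₛ : Series
  0ₛ _ = + 0

  κ : ℤ → Series
  κ c zero    = c
  κ c (suc _) = + 0

  1ₛ : Series
  1ₛ = κ (+ 1)

  infixl 6 _⊕_
  infixl 7 _⊛_ _·_

  _⊕_ : Series → Series → Series
  (f ⊕ g) n = f n + g n

  ⊝_ : Series → Series
  (⊝ f) n = - f n

  _·_ : ℤ → Series → Series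
  (c · f) n = c * f n

  _⊛_ : Series → Series → Series
  (f ⊛ g) zero    = f 0 * g 0
  (f ⊛ g) (suc n) = f 0 * g (suc n) + ((f ∘ suc) ⊛ g) n

  private
    ⊛-cong′ : ∀ {f f′ g g′} → f ≗ f′ → g ≗ g′ → f ⊛ g ≗ f′ ⊛ g′
    ⊛-cong′ f≗ g≗ zero    = cong₂ _*_ (f≗ 0) (g≗ 0)
    ⊛-cong′ f≗ g≗ (suc n) =
      cong₂ _+_ (cong₂ _*_ (f≗ 0) (g≗ (suc n))) (⊛-cong′ (f≗ ∘ suc) g≗ n)

    ⊛-distribʳ′ : ∀ f g h → (f ⊕ g) ⊛ h ≗ f ⊛ h ⊕ g ⊛ h
    ⊛-distribʳ′ f g h zero    = ℤ.*-distribʳ-+ (h 0) (f 0) (g 0)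
    ⊛-distribʳ′ f g h (suc n)
      rewrite ⊛-distribʳ′ (f ∘ suc) (g ∘ suc) h n
            | ℤ.*-distribʳ-+ (h (suc n)) (f 0) (g 0) =
        interchange (f 0 * h (suc n)) (g 0 * h (suc n)) (((f ∘ suc) ⊛ h) n) (((g ∘ suc) ⊛ h) n)
      where
      interchange : ∀ a b c d → a + b + (c + d) ≡ a + c + (b + d)
      interchange = solve-∀

    ·-⊛′ : ∀ c f g → (c · f) ⊛ g ≗ c · (f ⊛ g)
    ·-⊛′ c f g zero    = ℤ.*-assoc c (f 0) (g 0)
    ·-⊛′ c f g (suc n) rewrite ·-⊛′ c (f ∘ suc) g n = lemma c (f 0) (g (suc n)) _
      where
      lemma : ∀ a b c d → a * b * c + a * d ≡ a * (b * c + d)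
      lemma = solve-∀

    ⊛-zeroˡ′ : ∀ g → 0ₛ ⊛ g ≗ 0ₛ
    ⊛-zeroˡ′ g zero = refl
    ⊛-zeroˡ′ g (suc n) rewrite ⊛-zeroˡ′ g n | ℤ.*-zeroˡ (g (suc n)) = refl

    ⊛-identityˡ′ : ∀ g → 1ₛ ⊛ g ≗ g
    ⊛-identityˡ′ g zero    = ℤ.*-identityˡ (g 0)
    ⊛-identityˡ′ g (suc n) rewrite ⊛-zeroˡ′ g n =
      ≡.trans (ℤ.+-identityʳ _) (ℤ.*-identityˡ _)

    ⊛-assoc′ : ∀ f g h → (f ⊛ g) ⊛ h ≗ f ⊛ (g ⊛ h)
    ⊛-assoc′ f g h zero    = ℤ.*-assoc (f 0) (g 0) (h 0)
    ⊛-assoc′ f g h (suc n) = begin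
        f 0 * g 0 * h (suc n) + ((f 0 · (g ∘ suc) ⊕ (f ∘ suc) ⊛ g) ⊛ h) n
      ≡⟨ cong (_+_ (f 0 * g 0 * h (suc n))) (⊛-distribʳ′ (f 0 · (g ∘ suc)) ((f ∘ suc) ⊛ g) h n) ⟩
        f 0 * g 0 * h (suc n) + (((f 0 · (g ∘ suc)) ⊛ h) n + (((f ∘ suc) ⊛ g) ⊛ h) n)
      ≡⟨ cong₂ (λ u v → f 0 * g 0 * h (suc n) + (u + v))
               (·-⊛′ (f 0) (g ∘ suc) h n) (⊛-assoc′ (f ∘ suc) g h n) ⟩
        f 0 * g 0 * h (suc n) + (f 0 * ((g ∘ suc) ⊛ h) n + ((f ∘ suc) ⊛ (g ⊛ h)) n)
      ≡⟨ lemma (f 0) (g 0) (h (suc n)) _ _ ⟩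
        f 0 * (g 0 * h (suc n) + ((g ∘ suc) ⊛ h) n) + ((f ∘ suc) ⊛ (g ⊛ h)) n
      ∎
      where
      open ≡.≡-Reasoning
      lemma : ∀ a b c d e → a * b * c + (a * d + e) ≡ a * (b * c + d) + e
      lemma = solve-∀

    ⊛-sucʳ : ∀ f g n → (f ⊛ g) (suc n) ≡ (f ⊛ (g ∘ suc)) n + f (suc n) * g 0
    ⊛-sucʳ f g zero    = refl
    ⊛-sucʳ f g (suc n) rewrite ⊛-sucʳ (f ∘ suc) g n =
      ≡.sym (ℤ.+-assoc (f 0 * g (suc (suc n))) (((f ∘ suc) ⊛ (g ∘ suc)) n) (f (suc (suc n)) * g 0))

    ⊛-comm′ : ∀ f g → f ⊛ g ≗ g ⊛ f
    ⊛-comm′ f g zero    = ℤ.*-comm (f 0) (g 0)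
    ⊛-comm′ f g (suc n) rewrite ⊛-comm′ (f ∘ suc) g n | ⊛-sucʳ g f n =
      ≡.trans (ℤ.+-comm (f 0 * g (suc n)) ((g ⊛ (f ∘ suc)) n))
              (cong (_+_ ((g ⊛ (f ∘ suc)) n)) (ℤ.*-comm (f 0) (g (suc n))))

  isCommutativeRing : IsCommutativeRing _≈_ _⊕_ _⊛_ ⊝_ 0ₛ 1ₛ
  isCommutativeRing = record
    { isRing = record
      { +-isAbelianGroup = record
        { isGroup = record
          { isMonoid = record
            { isSemigroup = record
              { isMagma = record
                { isEquivalence = record
                  { refl  = mk≈ (λ _ → refl)
                  ; sym   = λ p → mk≈ (≡.sym ∘ at p)
                  ; trans = λ p q → mk≈ (λ n → ≡.trans (at p n) (at q n))
                  }
                ; ∙-cong = λ p q → mk≈ (λ n → cong₂ _+_ (at p n) (at q n))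
                }
              ; assoc = λ f g h → mk≈ (λ n → ℤ.+-assoc (f n) (g n) (h n))
              }
            ; identity = (λ f → mk≈ (ℤ.+-identityˡ ∘ f)) , (λ f → mk≈ (ℤ.+-identityʳ ∘ f))
            }
          ; inverse = (λ f → mk≈ (ℤ.+-inverseˡ ∘ f)) , (λ f → mk≈ (ℤ.+-inverseʳ ∘ f))
          ; ⁻¹-cong = λ p → mk≈ (cong -_ ∘ at p)
          }
        ; comm = λ f g → mk≈ (λ n → ℤ.+-comm (f n) (g n))
        }
      ; *-cong = λ p q → mk≈ (⊛-cong′ (at p) (at q))
      ; *-assoc = λ f g h → mk≈ (⊛-assoc′ f g h)
      ; *-identity = (λ g → mk≈ (⊛-identityˡ′ g))
                   , (λ g → mk≈ (λ n → ≡.trans (⊛-comm′ g 1ₛ n) (⊛-identityˡ′ g n)))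
      ; distrib = (λ f g h → mk≈ (λ n → ≡.trans (⊛-comm′ f (g ⊕ h) n)
                    (≡.trans (⊛-distribʳ′ g h f n) (cong₂ _+_ (⊛-comm′ g f n) (⊛-comm′ h f n)))))
                , (λ f g h → mk≈ (⊛-distribʳ′ g h f))
      }
    ; *-comm = λ f g → mk≈ (⊛-comm′ f g)
    }

  ring : CommutativeRing 0ℓ 0ℓ
  ring = record { isCommutativeRing = isCommutativeRing }

  open CommutativeRing ring public
    using (setoid)
    renaming ( refl to ≈-refl; sym to ≈-sym; trans to ≈-trans; reflexive to ≈-reflexive
             ; +-cong to ⊕-cong; +-congˡ to ⊕-congˡ; +-congʳ to ⊕-congʳ
             ; +-assoc to ⊕-assoc; +-identityˡ to ⊕-identityˡ; +-identityʳ to ⊕-identityʳ; +-comm to ⊕-comm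
             ; *-cong to ⊛-cong; *-congˡ to ⊛-congˡ; *-congʳ to ⊛-congʳ
             ; *-assoc to ⊛-assoc; *-comm to ⊛-comm
             ; *-identityˡ to ⊛-identityˡ; *-identityʳ to ⊛-identityʳ
             ; distribˡ to ⊛-distribˡ; distribʳ to ⊛-distribʳ
             ; zeroˡ to ⊛-zeroˡ; zeroʳ to ⊛-zeroʳ )

  κ-⊛ : ∀ c g → κ c ⊛ g ≈ c · g
  κ-⊛ c g = mk≈ go
    where
    go : κ c ⊛ g ≗ c · g
    go zero    = refl
    go (suc n) = ≡.trans (cong (_+_ (c * g (suc n))) (⊛-zeroˡ′ g n)) (ℤ.+-identityʳ _)

  private
    κ-morphism : ℤ.+-*-rawRing -Raw-AlmostCommutative⟶ fromCommutativeRing ring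
    κ-morphism = record
      { ⟦_⟧    = κ
      ; +-homo = λ c d → mk≈ λ { zero → refl ; (suc n) → refl }
      ; *-homo = λ c d → ≈-sym (≈-trans (κ-⊛ c (κ d)) (mk≈ λ { zero → refl ; (suc n) → ℤ.*-zeroʳ c }))
      ; -‿homo = λ c → mk≈ λ { zero → refl ; (suc n) → refl }
      ; 0-homo = mk≈ λ { zero → refl ; (suc n) → refl }
      ; 1-homo = ≈-refl
      }

    κ-≟ : (c d : ℤ) → Maybe (κ c ≈ κ d)
    κ-≟ c d with c ℤ.≟ d
    ... | yes refl = just ≈-refl
    ... | no _     = nothing

  open Algebra.Solver.Ring ℤ.+-*-rawRing (fromCommutativeRing ring) κ-morphism κ-≟ public
    using (solve; _:+_; _:*_; :-_; _:=_; con)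

  κ-⊛-κ : ∀ a b → κ a ⊛ κ b ≈ κ (a * b)
  κ-⊛-κ a b = ≈-sym (_-Raw-AlmostCommutative⟶_.*-homo κ-morphism a b)

module Monomials where

  open import Data.Nat using (_<_)
  open import Data.Integer using (_+_)

  open Series

  shift : ℕ → Series → Series
  shift zero    f         = f
  shift (suc a) f zero    = + 0
  shift (suc a) f (suc n) = shift a f n

  q^_ : ℕ → Series
  q^ a = shift a 1ₛ

  shift-low : ∀ a f {n} → n < a → shift a f n ≡ + 0
  shift-low (suc a) f {zero}  _         = refl
  shift-low (suc a) f {suc n} (s≤s n<a) = shift-low a f n<a

  shift-high : ∀ a f n → shift a f (a ℕ.+ n) ≡ f n
  shift-high zero    f n = refl
  shift-high (suc a) f n = shift-high a f n

  shift-cong : ∀ a {f g} → f ≈ g → shift a f ≈ shift a g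
  shift-cong zero    f≈g = f≈g
  shift-cong (suc a) f≈g = mk≈ λ { zero → refl ; (suc n) → at (shift-cong a f≈g) n }

  shift-shift : ∀ a b f → shift a (shift b f) ≈ shift (a ℕ.+ b) f
  shift-shift zero    b f = ≈-refl
  shift-shift (suc a) b f = mk≈ λ { zero → refl ; (suc n) → at (shift-shift a b f) n }

  shift-⊛ : ∀ a f g → shift a f ⊛ g ≈ shift a (f ⊛ g)
  shift-⊛ zero    f g = ≈-refl
  shift-⊛ (suc a) f g = mk≈ λ
    { zero    → ℤ.*-zeroˡ (g 0)
    ; (suc n) → ≡.trans (cong (_+ (shift a f ⊛ g) n) (ℤ.*-zeroˡ (g (suc n))))
                        (≡.trans (ℤ.+-identityˡ _) (at (shift-⊛ a f g) n)) }

  q^-⊛ : ∀ a g → q^ a ⊛ g ≈ shift a g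
  q^-⊛ a g = ≈-trans (shift-⊛ a 1ₛ g) (shift-cong a (⊛-identityˡ g))

  q^-+ : ∀ a b → q^ a ⊛ q^ b ≈ q^ (a ℕ.+ b)
  q^-+ a b = ≈-trans (q^-⊛ a (q^ b)) (shift-shift a b 1ₛ)

  q^-cong : ∀ {a b} → a ≡ b → q^ a ≈ q^ b
  q^-cong = ≈-reflexive ∘ cong q^_

  q^-at-self : ∀ e → (q^ e) e ≡ + 1
  q^-at-self zero    = refl
  q^-at-self (suc e) = q^-at-self e

  q^-at-other : ∀ e n → e ≢ n → (q^ e) n ≡ + 0
  q^-at-other zero    zero    e≢n = ⊥-elim (e≢n refl)
  q^-at-other zero    (suc n) _   = refl
  q^-at-other (suc e) zero    _   = refl
  q^-at-other (suc e) (suc n) e≢n = q^-at-other e n (e≢n ∘ cong suc)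

module Truncation where

  open import Data.Integer using (_+_; _-_; _*_)
  open import Data.Nat using (_≤_; _<_)
  open Series
  open Monomials

  infix 4 _≈[_]_
  record _≈[_]_ (f : Series) (M : ℕ) (g : Series) : Set where
    constructor mk≈[]
    field below : ∀ n → n < M → f n ≡ g n
  open _≈[_]_ public

  ≈⇒≈[] : ∀ {f g M} → f ≈ g → f ≈[ M ] g
  ≈⇒≈[] f≈g = mk≈[] (λ n _ → at f≈g n)

  ≈[]-refl : ∀ {f M} → f ≈[ M ] f
  ≈[]-refl = mk≈[] (λ _ _ → refl)

  ≈[]-sym : ∀ {f g M} → f ≈[ M ] g → g ≈[ M ] f
  ≈[]-sym p = mk≈[] (λ n n<M → ≡.sym (below p n n<M))

  ≈[]-trans : ∀ {f g h M} → f ≈[ M ] g → g ≈[ M ] h → f ≈[ M ] h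
  ≈[]-trans p q = mk≈[] (λ n n<M → ≡.trans (below p n n<M) (below q n n<M))

  ≈[]-setoid : ℕ → Setoid 0ℓ 0ℓ
  ≈[]-setoid M = record
    { Carrier = Series
    ; _≈_ = _≈[ M ]_
    ; isEquivalence = record { refl = ≈[]-refl ; sym = ≈[]-sym ; trans = ≈[]-trans }
    }

  module ≈[]-Reasoning (M : ℕ) = SetoidReasoning (≈[]-setoid M)

  ≈[]-mono : ∀ {f g M M′} → M′ ≤ M → f ≈[ M ] g → f ≈[ M′ ] g
  ≈[]-mono M′≤M p = mk≈[] (λ n n<M′ → below p n (ℕ.<-≤-trans n<M′ M′≤M))

  ⊛-local : ∀ n {f f′ g g′} → (∀ i → i ≤ n → f i ≡ f′ i) → (∀ i → i ≤ n → g i ≡ g′ i) →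
            (f ⊛ g) n ≡ (f′ ⊛ g′) n
  ⊛-local zero    f≡ g≡ = cong₂ _*_ (f≡ 0 z≤n) (g≡ 0 z≤n)
  ⊛-local (suc n) f≡ g≡ =
    cong₂ _+_ (cong₂ _*_ (f≡ 0 z≤n) (g≡ (suc n) ℕ.≤-refl))
              (⊛-local n (λ i i≤n → f≡ (suc i) (s≤s i≤n)) (λ i i≤n → g≡ i (ℕ.m≤n⇒m≤1+n i≤n)))

  ⊛-cong-≈[] : ∀ {f f′ g g′ M} → f ≈[ M ] f′ → g ≈[ M ] g′ → f ⊛ g ≈[ M ] f′ ⊛ g′
  ⊛-cong-≈[] p q = mk≈[] λ n n<M →
    ⊛-local n (λ i i≤n → below p i (ℕ.≤-<-trans i≤n n<M)) (λ i i≤n → below q i (ℕ.≤-<-trans i≤n n<M))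

  ⊕-cong-≈[] : ∀ {f f′ g g′ M} → f ≈[ M ] f′ → g ≈[ M ] g′ → f ⊕ g ≈[ M ] f′ ⊕ g′
  ⊕-cong-≈[] p q = mk≈[] (λ n n<M → cong₂ _+_ (below p n n<M) (below q n n<M))

  shift-cong-≈[] : ∀ a {f g M} → f ≈[ M ] g → shift a f ≈[ a ℕ.+ M ] shift a g
  shift-cong-≈[] zero    p = p
  shift-cong-≈[] (suc a) p = mk≈[] λ
    { zero    _             → refl
    ; (suc n) (s≤s n<a+M) → below (shift-cong-≈[] a p) n n<a+M }

  shift-cancel-≈[] : ∀ a {f g M} → shift a f ≈[ a ℕ.+ M ] shift a g → f ≈[ M ] g
  shift-cancel-≈[] zero    p = p
  shift-cancel-≈[] (suc a) p = shift-cancel-≈[] a (mk≈[] (λ n n<a+M → below p (suc n) (s≤s n<a+M)))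

  ⊛-at-first-nonzero : ∀ n u h → (∀ i → i < n → h i ≡ + 0) → (u ⊛ h) n ≡ u 0 * h n
  ⊛-at-first-nonzero zero    u h h<n≡0 = refl
  ⊛-at-first-nonzero (suc n) u h h<n≡0 = begin
      u 0 * h (suc n) + ((u ∘ suc) ⊛ h) n
    ≡⟨ cong (_+_ (u 0 * h (suc n))) (⊛-local n (λ _ _ → refl) (λ i i≤n → h<n≡0 i (s≤s i≤n))) ⟩
      u 0 * h (suc n) + ((u ∘ suc) ⊛ 0ₛ) n
    ≡⟨ cong (_+_ (u 0 * h (suc n))) (at (⊛-zeroʳ (u ∘ suc)) n) ⟩
      u 0 * h (suc n) + + 0
    ≡⟨ ℤ.+-identityʳ _ ⟩
      u 0 * h (suc n)
    ∎
    where open ≡.≡-Reasoning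

  cancel-≈[] : ∀ u {f g M} → u 0 ≡ + 1 → u ⊛ f ≈[ M ] u ⊛ g → f ≈[ M ] g
  cancel-≈[] u {f} {g} {M} u0≡1 uf≈ug =
    mk≈[] (λ n n<M → ℤ.i-j≡0⇒i≡j (f n) (g n) (vanish M ℕ.≤-refl n n<M))
    where
    h : Series
    h = f ⊕ ⊝ g
    uh≈0 : u ⊛ h ≈[ M ] 0ₛ
    uh≈0 = mk≈[] λ n n<M → begin
        (u ⊛ h) n
      ≡⟨ at (solve 3 (λ u f g → u :* (f :+ :- g) := u :* f :+ :- (u :* g)) ≈-refl u f g) n ⟩
        (u ⊛ f) n - (u ⊛ g) n
      ≡⟨ cong (_- (u ⊛ g) n) (below uf≈ug n n<M) ⟩
        (u ⊛ g) n - (u ⊛ g) n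
      ≡⟨ ℤ.+-inverseʳ ((u ⊛ g) n) ⟩
        + 0
      ∎
      where open ≡.≡-Reasoning
    vanish : ∀ N → N ≤ M → ∀ i → i < N → h i ≡ + 0
    vanish (suc N) N<M i (s≤s i≤N) with ℕ.m≤n⇒m<n∨m≡n i≤N
    ... | inj₁ i<N  = vanish N (ℕ.<⇒≤ N<M) i i<N
    ... | inj₂ refl = begin
        h i                ≡⟨ ℤ.*-identityˡ (h i) ⟨
        + 1 * h i          ≡⟨ cong (_* h i) u0≡1 ⟨
        u 0 * h i          ≡⟨ ⊛-at-first-nonzero i u h (vanish i (ℕ.<⇒≤ N<M)) ⟨
        (u ⊛ h) i          ≡⟨ below uh≈0 i N<M ⟩
        + 0                ∎
      where open ≡.≡-Reasoning

module Products where

  open import Data.Nat using (_<_)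
  open import Data.Integer using (_+_; _*_; _^_)

  open Series
  open Monomials
  open Truncation

  open BigOperator (CommutativeRing.+-commutativeMonoid ring) public
    using () renaming (big to ∑; big-cong to ∑-cong; big-suc-last to ∑-suc-last; big-+ to ∑-+;
                       big-∙ to ∑-⊕; big-blocks to ∑-blocks; big-reverse to ∑-reverse)
  open BigOperator (CommutativeRing.*-commutativeMonoid ring) public
    using () renaming (big to ∏; big-cong to ∏-cong; big-ε to ∏-1; big-suc-last to ∏-suc-last;
                       big-+ to ∏-+; big-∙ to ∏-⊛; big-blocks to ∏-blocks; big-swap to ∏-swap;
                       big-reverse to ∏-reverse)

  infixr 8 _^ₛ_
  _^ₛ_ : Series → ℕ → Series
  x ^ₛ k = ∏ k (λ _ → x)

  ⊛-∑ : ∀ n g F → g ⊛ ∑ n F ≈ ∑ n (λ i → g ⊛ F i)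
  ⊛-∑ zero    g F = ⊛-zeroʳ g
  ⊛-∑ (suc n) g F = ≈-trans (⊛-distribˡ g (F 0) _) (⊕-congˡ {x = g ⊛ F 0} (⊛-∑ n g (F ∘ suc)))

  ∑-at-zero : ∀ K f n → (∀ i → i < K → f i n ≡ + 0) → ∑ K f n ≡ + 0
  ∑-at-zero zero    f n _      = refl
  ∑-at-zero (suc K) f n f·n≡0 =
    cong₂ _+_ (f·n≡0 0 (s≤s z≤n)) (∑-at-zero K (f ∘ suc) n (λ i i<K → f·n≡0 (suc i) (s≤s i<K)))

  ∑-at-single : ∀ K f n m → m < K → (∀ i → i < K → i ≢ m → f i n ≡ + 0) → ∑ K f n ≡ f m n
  ∑-at-single (suc K) f n zero    _         others = ≡.trans
    (cong (_+_ (f 0 n)) (∑-at-zero K (f ∘ suc) n (λ i i<K → others (suc i) (s≤s i<K) (λ ()))))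
    (ℤ.+-identityʳ (f 0 n))
  ∑-at-single (suc K) f n (suc m) (s≤s m<K) others = ≡.trans
    (cong₂ _+_ (others 0 (s≤s z≤n) (λ ()))
               (∑-at-single K (f ∘ suc) n m m<K λ i i<K i≢m → others (suc i) (s≤s i<K) (i≢m ∘ ℕ.suc-injective)))
    (ℤ.+-identityˡ _)

  ∏-cong-≈[] : ∀ n {f g M} → (∀ i → i < n → f i ≈[ M ] g i) → ∏ n f ≈[ M ] ∏ n g
  ∏-cong-≈[] zero    p = ≈[]-refl
  ∏-cong-≈[] (suc n) p = ⊛-cong-≈[] (p 0 (s≤s z≤n)) (∏-cong-≈[] n (λ i i<n → p (suc i) (s≤s i<n)))

  ∑-cong-≈[] : ∀ n {f g M} → (∀ i → i < n → f i ≈[ M ] g i) → ∑ n f ≈[ M ] ∑ n g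
  ∑-cong-≈[] zero    p = ≈[]-refl
  ∑-cong-≈[] (suc n) p = ⊕-cong-≈[] (p 0 (s≤s z≤n)) (∑-cong-≈[] n (λ i i<n → p (suc i) (s≤s i<n)))

  ∏-≈[]-drop : ∀ n k f {M} → (∀ i → i < k → f (n ℕ.+ i) ≈[ M ] 1ₛ) → ∏ (n ℕ.+ k) f ≈[ M ] ∏ n f
  ∏-≈[]-drop n k f p = begin
    ∏ (n ℕ.+ k) f                       ≈⟨ ≈⇒≈[] (∏-+ n k f) ⟩
    ∏ n f ⊛ ∏ k (f ∘ (n ℕ.+_))           ≈⟨ ⊛-cong-≈[] ≈[]-refl (∏-cong-≈[] k p) ⟩
    ∏ n f ⊛ ∏ k (λ _ → 1ₛ)               ≈⟨ ≈⇒≈[] (≈-trans (⊛-congˡ (∏-1 k)) (⊛-identityʳ _)) ⟩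
    ∏ n f                                ∎
    where open ≈[]-Reasoning _

  ∏-constant-term : ∀ n f → (∀ i → i < n → f i 0 ≡ + 1) → ∏ n f 0 ≡ + 1
  ∏-constant-term zero    f p = refl
  ∏-constant-term (suc n) f p =
    cong₂ _*_ (p 0 (s≤s z≤n)) (∏-constant-term n (f ∘ suc) (λ i i<n → p (suc i) (s≤s i<n)))

  κ-^ₛ : ∀ s k → κ s ^ₛ k ≈ κ (s ^ k)
  κ-^ₛ s zero    = ≈-refl
  κ-^ₛ s (suc k) = ≈-trans (⊛-congˡ (κ-^ₛ s k)) (κ-⊛-κ s (s ^ k))

  q^-^ₛ : ∀ a k → q^ a ^ₛ k ≈ q^ (a ℕ.* k)
  q^-^ₛ a zero    = q^-cong (≡.sym (ℕ.*-zeroʳ a))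
  q^-^ₛ a (suc k) = ≈-trans (⊛-congˡ (q^-^ₛ a k)) (≈-trans (q^-+ a (a ℕ.* k)) (q^-cong (≡.sym (ℕ.*-suc a k))))

module Triangular where

  open import Data.Nat using (_≤_; _+_; _*_)
  open import Data.Nat.Tactic.RingSolver using (solve-∀)

  -- tri k = k (k - 1) / 2, so that T n = tri (n + 1).
  tri : ℕ → ℕ
  tri zero    = 0
  tri (suc k) = tri k + k

  tri-+ : ∀ x y → tri (x + y) ≡ tri x + tri y + x * y
  tri-+ x zero    = ≡.trans (cong tri (ℕ.+-identityʳ x)) (solve-∀′ (tri x) x)
    where
    solve-∀′ : ∀ t x → t ≡ t + 0 + x * 0
    solve-∀′ = solve-∀
  tri-+ x (suc y) = begin
    tri (x + suc y)                       ≡⟨ cong tri (ℕ.+-suc x y) ⟩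
    tri (x + y) + (x + y)                 ≡⟨ cong (_+ (x + y)) (tri-+ x y) ⟩
    tri x + tri y + x * y + (x + y)       ≡⟨ lemma (tri x) (tri y) x y ⟩
    tri x + (tri y + y) + x * suc y       ∎
    where
    open ≡.≡-Reasoning
    lemma : ∀ tx ty x y → tx + ty + x * y + (x + y) ≡ tx + (ty + y) + x * suc y
    lemma = solve-∀

  tri-suc-double : ∀ j → tri (suc j) + tri (suc j) ≡ suc j * j
  tri-suc-double zero    = refl
  tri-suc-double (suc j) = begin
    tri (suc j) + suc j + (tri (suc j) + suc j) ≡⟨ lemma (tri (suc j)) j ⟩
    tri (suc j) + tri (suc j) + suc j + suc j   ≡⟨ cong (λ t → t + suc j + suc j) (tri-suc-double j) ⟩
    suc j * j + suc j + suc j                   ≡⟨ lemma′ j ⟩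
    suc (suc j) * suc j                         ∎
    where
    open ≡.≡-Reasoning
    lemma : ∀ t j → t + suc j + (t + suc j) ≡ t + t + suc j + suc j
    lemma = solve-∀
    lemma′ : ∀ j → suc j * j + suc j + suc j ≡ suc (suc j) * suc j
    lemma′ = solve-∀

  tri-mono : ∀ {x y} → x ≤ y → tri x ≤ tri y
  tri-mono {x} {y} x≤y = ≡.subst (λ z → tri x ≤ tri z) (ℕ.m+[n∸m]≡n x≤y)
    (≡.subst (tri x ≤_) (≡.sym (tri-+ x (y ∸ x))) (ℕ.≤-trans (ℕ.m≤m+n (tri x) (tri (y ∸ x))) (ℕ.m≤m+n _ _)))

module Pochhammer where

  open import Data.Nat using (_≤_; _<_)
  open import Data.Integer using (_+_; _*_)

  open Series
  open Monomials
  open Truncation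
  open Products

  factor : ℤ → ℕ → Series
  factor s e = 1ₛ ⊕ κ s ⊛ q^ e

  -- poch s u v n = ∏_{i<n} (1 + s q^(u i + v)), i.e. (-s q^v; q^u)_n
  poch : ℤ → ℕ → ℕ → ℕ → Series
  poch s u v n = ∏ n (λ i → factor s (u ℕ.* i ℕ.+ v))

  factor-cong : ∀ s {e e′} → e ≡ e′ → factor s e ≈ factor s e′
  factor-cong s = ≈-reflexive ∘ cong (factor s)

  factor-≈[]1 : ∀ s e {M} → M ≤ e → factor s e ≈[ M ] 1ₛ
  factor-≈[]1 s e M≤e = mk≈[] λ n n<M → begin
    1ₛ n + (κ s ⊛ q^ e) n      ≡⟨ cong (_+_ (1ₛ n)) (at (κ-⊛ s (q^ e)) n) ⟩
    1ₛ n + s * (q^ e) n        ≡⟨ cong (λ z → 1ₛ n + s * z) (shift-low e 1ₛ (ℕ.<-≤-trans n<M M≤e)) ⟩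
    1ₛ n + s * + 0             ≡⟨ cong (_+_ (1ₛ n)) (ℤ.*-zeroʳ s) ⟩
    1ₛ n + + 0                 ≡⟨ ℤ.+-identityʳ (1ₛ n) ⟩
    1ₛ n                       ∎
    where open ≡.≡-Reasoning

  factor-constant-term : ∀ s {e} → 0 < e → factor s e 0 ≡ + 1
  factor-constant-term s {suc e} _ = cong (_+_ (+ 1)) (ℤ.*-zeroʳ s)

  poch-constant-term : ∀ s u {v} n → 0 < v → poch s u v n 0 ≡ + 1
  poch-constant-term s u {v} n 0<v = ∏-constant-term n _ λ i _ →
    factor-constant-term s (ℕ.<-≤-trans 0<v (ℕ.m≤n+m v (u ℕ.* i)))

  poch-≈[]-drop : ∀ s u v n k {M} → M ≤ u ℕ.* n ℕ.+ v → poch s u v (n ℕ.+ k) ≈[ M ] poch s u v n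
  poch-≈[]-drop s u v n k M≤ = ∏-≈[]-drop n k _ λ i _ →
    factor-≈[]1 s _ (ℕ.≤-trans M≤ (ℕ.+-monoˡ-≤ v (ℕ.*-monoʳ-≤ u (ℕ.m≤m+n n i))))

  poch-≈[] : ∀ s u v {M N} .{{_ : ℕ.NonZero u}} → M ≤ N → poch s u v N ≈[ M ] poch s u v M
  poch-≈[] s u v {M} M≤N = ≡.subst (λ K → poch s u v K ≈[ M ] poch s u v M) (ℕ.m+[n∸m]≡n M≤N)
    (poch-≈[]-drop s u v M (_ ∸ M) (ℕ.≤-trans (ℕ.m≤n*m M u) (ℕ.m≤m+n _ v)))

  poch-dissect : ∀ s u v r n → poch s u v (n ℕ.* r) ≈ ∏ r (λ j → poch s (r ℕ.* u) (u ℕ.* j ℕ.+ v) n)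
  poch-dissect s u v r n = ≈-trans (∏-blocks n r _) (≈-trans (∏-swap n r _)
    (∏-cong r λ j _ → ∏-cong n λ i _ → factor-cong s (exponent u v r i j)))
    where
    open import Data.Nat.Tactic.RingSolver using (solve-∀)
    exponent : ∀ u v r i j → u ℕ.* (i ℕ.* r ℕ.+ j) ℕ.+ v ≡ r ℕ.* u ℕ.* i ℕ.+ (u ℕ.* j ℕ.+ v)
    exponent = solve-∀

  qfac : ℕ → ℕ → Series
  qfac b = poch -1ℤ b b

  qfac-suc : ∀ b N → qfac b (suc N) ≈ qfac b N ⊛ factor -1ℤ (b ℕ.* suc N)
  qfac-suc b N = ≈-trans (∏-suc-last N _)
    (⊛-congˡ (factor-cong _ (≡.trans (ℕ.+-comm (b ℕ.* N) b) (≡.sym (ℕ.*-suc b N)))))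

module Gaussian (b : ℕ) where

  open import Data.Nat using (_≤_; _<_)
  open Series
  open Monomials
  open Truncation
  open Products
  open Pochhammer
  open Triangular

  gauss : ℕ → ℕ → Series
  gauss _       zero    = 1ₛ
  gauss zero    (suc k) = 0ₛ
  gauss (suc N) (suc k) = gauss N k ⊕ q^ (b ℕ.* suc k) ⊛ gauss N (suc k)

  gauss-above : ∀ N k → N < k → gauss N k ≈ 0ₛ
  gauss-above zero    (suc k) _         = ≈-refl
  gauss-above (suc N) (suc k) (s≤s N<k) = ≈-trans
    (⊕-cong (gauss-above N k N<k) (⊛-congˡ (gauss-above N (suc k) (ℕ.m<n⇒m<1+n N<k))))
    (≈-trans (⊕-identityˡ _) (⊛-zeroʳ _))

  binomialTerm : ℕ → Series → Series → ℕ → Series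
  binomialTerm N x y k = gauss N k ⊛ q^ (b ℕ.* tri k) ⊛ y ^ₛ k ⊛ x ^ₛ (N ∸ k)

  q^-tri-suc : ∀ k → q^ (b ℕ.* tri k) ⊛ q^ (b ℕ.* k) ≈ q^ (b ℕ.* tri (suc k))
  q^-tri-suc k = ≈-trans (q^-+ (b ℕ.* tri k) (b ℕ.* k)) (q^-cong (≡.sym (ℕ.*-distribˡ-+ b (tri k) k)))

  ∏-q^-linear : ∀ m → ∏ m (λ i → q^ (b ℕ.* i)) ≈ q^ (b ℕ.* tri m)
  ∏-q^-linear zero    = ≈-sym (q^-cong (ℕ.*-zeroʳ b))
  ∏-q^-linear (suc m) = ≈-trans (∏-suc-last m _) (≈-trans (⊛-congʳ (∏-q^-linear m)) (q^-tri-suc m))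

  private
    q^-b*0 : q^ (b ℕ.* 0) ≈ 1ₛ
    q^-b*0 = q^-cong (ℕ.*-zeroʳ b)

    -- the binomial terms after the substitution y ↦ y q^b
    shiftedTerm : ℕ → Series → Series → ℕ → Series
    shiftedTerm N x y k = gauss N k ⊛ q^ (b ℕ.* tri (suc k)) ⊛ y ^ₛ k ⊛ x ^ₛ (N ∸ k)

    binomialTerm-shift : ∀ N x y k → binomialTerm N x (y ⊛ q^ b) k ≈ shiftedTerm N x y k
    binomialTerm-shift N x y k = begin
        gauss N k ⊛ q^ (b ℕ.* tri k) ⊛ (y ⊛ q^ b) ^ₛ k ⊛ x ^ₛ (N ∸ k)
      ≈⟨ ⊛-congʳ (⊛-congˡ (≈-trans (∏-⊛ k _ _) (⊛-congˡ (q^-^ₛ b k)))) ⟩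
        gauss N k ⊛ q^ (b ℕ.* tri k) ⊛ (y ^ₛ k ⊛ q^ (b ℕ.* k)) ⊛ x ^ₛ (N ∸ k)
      ≈⟨ solve 5 (λ g t Y e X → g :* t :* (Y :* e) :* X := g :* (t :* e) :* Y :* X) ≈-refl
               (gauss N k) (q^ (b ℕ.* tri k)) (y ^ₛ k) (q^ (b ℕ.* k)) (x ^ₛ (N ∸ k)) ⟩
        gauss N k ⊛ (q^ (b ℕ.* tri k) ⊛ q^ (b ℕ.* k)) ⊛ y ^ₛ k ⊛ x ^ₛ (N ∸ k)
      ≈⟨ ⊛-congʳ (⊛-congʳ (⊛-congˡ (q^-tri-suc k))) ⟩
        shiftedTerm N x y k
      ∎
      where open SetoidReasoning setoid

    binomialTerm-suc-zero : ∀ N x y → binomialTerm (suc N) x y 0 ≈ x ⊛ shiftedTerm N x y 0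
    binomialTerm-suc-zero N x y = solve 3 (λ t x X → con (+ 1) :* t :* con (+ 1) :* (x :* X)
                                                   := x :* (con (+ 1) :* t :* con (+ 1) :* X))
                                          ≈-refl (q^ (b ℕ.* 0)) x (x ^ₛ N)

    gauss-⊛-power : ∀ N k x z →
      gauss N (suc k) ⊛ z ⊛ x ^ₛ (N ∸ k) ≈ x ⊛ (gauss N (suc k) ⊛ z ⊛ x ^ₛ (N ∸ suc k))
    gauss-⊛-power N k x z with k ℕ.<? N
    ... | yes k<N = ≈-trans (⊛-congˡ (≈-reflexive (cong (x ^ₛ_) (ℕ.+-∸-assoc 1 k<N))))
                            (solve 4 (λ g z x X → g :* z :* (x :* X) := x :* (g :* z :* X)) ≈-refl
                                   (gauss N (suc k)) z x (x ^ₛ (N ∸ suc k)))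
    ... | no k≮N = ≈-trans (vanish (x ^ₛ (N ∸ k))) (≈-sym (≈-trans (⊛-congˡ (vanish _)) (⊛-zeroʳ x)))
      where
      vanish : ∀ X → gauss N (suc k) ⊛ z ⊛ X ≈ 0ₛ
      vanish X = ≈-trans (⊛-congʳ (⊛-congʳ (gauss-above N (suc k) (s≤s (ℕ.≮⇒≥ k≮N)))))
                         (≈-trans (⊛-congʳ (⊛-zeroˡ z)) (⊛-zeroˡ X))

    binomialTerm-suc-suc : ∀ N x y k →
      binomialTerm (suc N) x y (suc k) ≈ y ⊛ shiftedTerm N x y k ⊕ x ⊛ shiftedTerm N x y (suc k)
    binomialTerm-suc-suc N x y k = begin
        (g ⊕ e ⊛ g′) ⊛ t ⊛ (y ⊛ Y) ⊛ X
      ≈⟨ solve 7 (λ g e g′ t y Y X → (g :+ e :* g′) :* t :* (y :* Y) :* X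
                                   := y :* (g :* t :* Y :* X) :+ g′ :* (t :* e :* (y :* Y)) :* X)
               ≈-refl g e g′ t y Y X ⟩
        y ⊛ shiftedTerm N x y k ⊕ g′ ⊛ (t ⊛ e ⊛ (y ⊛ Y)) ⊛ X
      ≈⟨ ⊕-congˡ {x = y ⊛ shiftedTerm N x y k} (gauss-⊛-power N k x _) ⟩
        y ⊛ shiftedTerm N x y k ⊕ x ⊛ (g′ ⊛ (t ⊛ e ⊛ (y ⊛ Y)) ⊛ x ^ₛ (N ∸ suc k))
      ≈⟨ ⊕-congˡ {x = y ⊛ shiftedTerm N x y k}
                 (⊛-congˡ (⊛-congʳ (≈-trans (⊛-congˡ (⊛-congʳ (q^-tri-suc (suc k)))) (≈-sym (⊛-assoc g′ _ _))))) ⟩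
        y ⊛ shiftedTerm N x y k ⊕ x ⊛ shiftedTerm N x y (suc k)
      ∎
      where
      open SetoidReasoning setoid
      g g′ e t Y X : Series
      g = gauss N k
      g′ = gauss N (suc k)
      e = q^ (b ℕ.* suc k)
      t = q^ (b ℕ.* tri (suc k))
      Y = y ^ₛ k
      X = x ^ₛ (N ∸ k)

    shiftedTerm-top : ∀ N x y → shiftedTerm N x y (suc N) ≈ 0ₛ
    shiftedTerm-top N x y = ≈-trans (⊛-congʳ (⊛-congʳ (⊛-congʳ (gauss-above N (suc N) ℕ.≤-refl))))
      (≈-trans (⊛-congʳ (⊛-congʳ (⊛-zeroˡ _))) (≈-trans (⊛-congʳ (⊛-zeroˡ _)) (⊛-zeroˡ _)))

  qBinomial : ∀ N x y → ∏ N (λ i → x ⊕ y ⊛ q^ (b ℕ.* i)) ≈ ∑ (suc N) (binomialTerm N x y)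
  qBinomial zero x y = ≈-sym (≈-trans (⊕-identityʳ _) (≈-trans
    (solve 1 (λ t → con (+ 1) :* t :* con (+ 1) :* con (+ 1) := t) ≈-refl (q^ (b ℕ.* 0))) q^-b*0))
  qBinomial (suc N) x y = begin
      (x ⊕ y ⊛ q^ (b ℕ.* 0)) ⊛ ∏ N (λ i → x ⊕ y ⊛ q^ (b ℕ.* suc i))
    ≈⟨ ⊛-cong (⊕-congˡ {x = x} (≈-trans (⊛-congˡ q^-b*0) (⊛-identityʳ y)))
              (∏-cong N (λ i _ → ⊕-congˡ {x = x} (reindex i))) ⟩
      (x ⊕ y) ⊛ ∏ N (λ i → x ⊕ (y ⊛ q^ b) ⊛ q^ (b ℕ.* i))
    ≈⟨ ⊛-congˡ (qBinomial N x (y ⊛ q^ b)) ⟩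
      (x ⊕ y) ⊛ ∑ (suc N) (binomialTerm N x (y ⊛ q^ b))
    ≈⟨ ⊛-congˡ (∑-cong (suc N) (λ k _ → binomialTerm-shift N x y k)) ⟩
      (x ⊕ y) ⊛ ∑ (suc N) U
    ≈⟨ ≈-trans (⊛-distribʳ _ x y) (⊕-cong (⊛-∑ (suc N) x U) (⊛-∑ (suc N) y U)) ⟩
      ∑ (suc N) xU ⊕ ∑ (suc N) yU
    ≈⟨ ⊕-congʳ {x = ∑ (suc N) yU} (≈-sym (≈-trans (∑-suc-last (suc N) xU)
                 (≈-trans (⊕-congˡ {x = ∑ (suc N) xU} (≈-trans (⊛-congˡ (shiftedTerm-top N x y)) (⊛-zeroʳ x)))
                          (⊕-identityʳ (∑ (suc N) xU))))) ⟩
      (xU 0 ⊕ ∑ (suc N) (xU ∘ suc)) ⊕ ∑ (suc N) yU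
    ≈⟨ solve 3 (λ a c d → (a :+ c) :+ d := a :+ (d :+ c)) ≈-refl (xU 0) (∑ (suc N) (xU ∘ suc)) (∑ (suc N) yU) ⟩
      xU 0 ⊕ (∑ (suc N) yU ⊕ ∑ (suc N) (xU ∘ suc))
    ≈⟨ ⊕-cong (≈-sym (binomialTerm-suc-zero N x y))
              (≈-trans (≈-sym (∑-⊕ (suc N) yU (xU ∘ suc)))
                       (∑-cong (suc N) (λ k _ → ≈-sym (binomialTerm-suc-suc N x y k)))) ⟩
      ∑ (suc (suc N)) (binomialTerm (suc N) x y)
    ∎
    where
    open SetoidReasoning setoid
    U : ℕ → Series
    U = shiftedTerm N x y
    xU yU : ℕ → Series
    xU k = x ⊛ U k
    yU k = y ⊛ U k
    reindex : ∀ i → y ⊛ q^ (b ℕ.* suc i) ≈ (y ⊛ q^ b) ⊛ q^ (b ℕ.* i)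
    reindex i = ≈-trans (⊛-congˡ (≈-sym (≈-trans (q^-+ b (b ℕ.* i)) (q^-cong (≡.sym (ℕ.*-suc b i))))))
                        (≈-sym (⊛-assoc y (q^ b) _))

  gauss-diagonal : ∀ N → gauss N N ≈ 1ₛ
  gauss-diagonal zero    = ≈-refl
  gauss-diagonal (suc N) = ≈-trans (⊕-cong (gauss-diagonal N) (⊛-congˡ (gauss-above N (suc N) ℕ.≤-refl)))
                                   (≈-trans (⊕-congˡ {x = 1ₛ} (⊛-zeroʳ _)) (⊕-identityʳ 1ₛ))

  gauss-qfac-diagonal : ∀ N → gauss N N ⊛ qfac b N ⊛ qfac b (N ∸ N) ≈ qfac b N
  gauss-qfac-diagonal N = ≈-trans (⊛-cong (⊛-congʳ (gauss-diagonal N)) (≈-reflexive (cong (qfac b) (ℕ.n∸n≡0 N))))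
    (solve 1 (λ w → con (+ 1) :* w :* con (+ 1) := w) ≈-refl (qfac b N))

  -- Pascal's rule for gauss, and (1 - x) + x (1 - y) = 1 - x y.
  gauss-qfac : ∀ N k → k ≤ N → gauss N k ⊛ qfac b k ⊛ qfac b (N ∸ k) ≈ qfac b N
  gauss-qfac N       zero    _ = solve 1 (λ w → con (+ 1) :* con (+ 1) :* w := w) ≈-refl (qfac b N)
  gauss-qfac (suc N) (suc k) (s≤s k≤N) with ℕ.m≤n⇒m<n∨m≡n k≤N
  ... | inj₂ refl = gauss-qfac-diagonal (suc k)
  ... | inj₁ k<N = begin
      (g ⊕ e₁ ⊛ g′) ⊛ qfac b (suc k) ⊛ qfac b (N ∸ k)
    ≈⟨ ⊛-cong (⊛-congˡ (qfac-suc b k)) (≈-trans (≈-reflexive (cong (qfac b) N∸k≡1+m)) (qfac-suc b m)) ⟩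
      (g ⊕ e₁ ⊛ g′) ⊛ (w ⊛ f₁) ⊛ (w′ ⊛ f₂)
    ≈⟨ solve 6 (λ g e₁ g′ w w′ e₂ →
                 (g :+ e₁ :* g′) :* (w :* (con (+ 1) :+ con -1ℤ :* e₁)) :* (w′ :* (con (+ 1) :+ con -1ℤ :* e₂))
              := g :* w :* (w′ :* (con (+ 1) :+ con -1ℤ :* e₂)) :* (con (+ 1) :+ con -1ℤ :* e₁)
                 :+ e₁ :* (con (+ 1) :+ con -1ℤ :* e₂) :* (g′ :* (w :* (con (+ 1) :+ con -1ℤ :* e₁)) :* w′))
             ≈-refl g e₁ g′ w w′ e₂ ⟩
      g ⊛ w ⊛ (w′ ⊛ f₂) ⊛ f₁ ⊕ e₁ ⊛ f₂ ⊛ (g′ ⊛ (w ⊛ f₁) ⊛ w′)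
    ≈⟨ ⊕-cong (⊛-congʳ left) (⊛-congˡ right) ⟩
      W ⊛ f₁ ⊕ e₁ ⊛ f₂ ⊛ W
    ≈⟨ solve 3 (λ W e₁ e₂ → W :* (con (+ 1) :+ con -1ℤ :* e₁) :+ e₁ :* (con (+ 1) :+ con -1ℤ :* e₂) :* W
                          := W :* (con (+ 1) :+ con -1ℤ :* (e₁ :* e₂)))
             ≈-refl W e₁ e₂ ⟩
      W ⊛ (1ₛ ⊕ κ -1ℤ ⊛ (e₁ ⊛ e₂))
    ≈⟨ ⊛-congˡ (⊕-congˡ {x = 1ₛ} (⊛-congˡ (≈-trans (q^-+ (b ℕ.* suc k) (b ℕ.* suc m)) (q^-cong exponent)))) ⟩
      W ⊛ factor -1ℤ (b ℕ.* suc N)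
    ≈⟨ qfac-suc b N ⟨
      qfac b (suc N)
    ∎
    where
    open SetoidReasoning setoid
    m : ℕ
    m = N ∸ suc k
    N∸k≡1+m : N ∸ k ≡ suc m
    N∸k≡1+m = ℕ.+-∸-assoc 1 k<N
    g g′ e₁ e₂ f₁ f₂ w w′ W : Series
    g = gauss N k
    g′ = gauss N (suc k)
    e₁ = q^ (b ℕ.* suc k)
    e₂ = q^ (b ℕ.* suc m)
    f₁ = factor -1ℤ (b ℕ.* suc k)
    f₂ = factor -1ℤ (b ℕ.* suc m)
    w = qfac b k
    w′ = qfac b m
    W = qfac b N
    left : g ⊛ w ⊛ (w′ ⊛ f₂) ≈ W
    left = ≈-trans (⊛-congˡ (≈-sym (≈-trans (≈-reflexive (cong (qfac b) N∸k≡1+m)) (qfac-suc b m))))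
                   (gauss-qfac N k k≤N)
    right : g′ ⊛ (w ⊛ f₁) ⊛ w′ ≈ W
    right = ≈-trans (⊛-congʳ (⊛-congˡ (≈-sym (qfac-suc b k)))) (gauss-qfac N (suc k) k<N)
    exponent : b ℕ.* suc k ℕ.+ b ℕ.* suc m ≡ b ℕ.* suc N
    exponent = ≡.trans (≡.sym (ℕ.*-distribˡ-+ b (suc k) (suc m)))
                       (cong (b ℕ.*_) (≡.trans (ℕ.+-suc (suc k) m) (cong suc (ℕ.m+[n∸m]≡n k<N))))

  qfac-≈[]-drop : ∀ n k {M} → M ≤ b ℕ.* suc n → qfac b (n ℕ.+ k) ≈[ M ] qfac b n
  qfac-≈[]-drop n k {M} M≤ = poch-≈[]-drop _ b b n k
    (≡.subst (M ≤_) (≡.trans (ℕ.*-suc b n) (ℕ.+-comm b (b ℕ.* n))) M≤)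

  gauss⊛qfac≈[]1 : ∀ N k {M} .{{_ : ℕ.NonZero b}} → k ≤ N → M ≤ b ℕ.* suc k → M ≤ b ℕ.* suc (N ∸ k) →
                   gauss N k ⊛ qfac b N ≈[ M ] 1ₛ
  gauss⊛qfac≈[]1 N k {M} k≤N M≤₁ M≤₂ = cancel-≈[] W (poch-constant-term _ b N (ℕ.>-nonZero⁻¹ b)) (begin
      W ⊛ (gauss N k ⊛ W)                ≈⟨ ≈⇒≈[] (solve 2 (λ w g → w :* (g :* w) := g :* w :* w) ≈-refl W (gauss N k)) ⟩
      gauss N k ⊛ W ⊛ W                  ≈⟨ ⊛-cong-≈[] (⊛-cong-≈[] ≈[]-refl Wk≈W) Wr≈W ⟨
      gauss N k ⊛ qfac b k ⊛ qfac b (N ∸ k) ≈⟨ ≈⇒≈[] (gauss-qfac N k k≤N) ⟩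
      W                                  ≈⟨ ≈⇒≈[] (⊛-identityʳ W) ⟨
      W ⊛ 1ₛ                             ∎)
    where
    open ≈[]-Reasoning M
    W : Series
    W = qfac b N
    Wk≈W : qfac b k ≈[ M ] W
    Wk≈W = ≈[]-sym (≡.subst (λ n → qfac b n ≈[ M ] qfac b k) (ℕ.m+[n∸m]≡n k≤N) (qfac-≈[]-drop k (N ∸ k) M≤₁))
    Wr≈W : qfac b (N ∸ k) ≈[ M ] W
    Wr≈W = ≈[]-sym (≡.subst (λ n → qfac b n ≈[ M ] qfac b (N ∸ k)) (ℕ.m∸n+n≡m k≤N) (qfac-≈[]-drop (N ∸ k) k M≤₂))

module Sign (s : ℤ) (s²≡1 : s ℤ.* s ≡ + 1) where

  open import Data.Integer using (_*_; _^_)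
  open import Data.Integer.Tactic.RingSolver using (solve-∀)

  ^-square : ∀ x → s ^ x * s ^ x ≡ + 1
  ^-square zero    = refl
  ^-square (suc x) = ≡.trans (interchange s (s ^ x)) (cong₂ _*_ s²≡1 (^-square x))
    where
    interchange : ∀ a b → a * b * (a * b) ≡ a * a * (b * b)
    interchange = solve-∀

  ^-even : ∀ x → s ^ (x ℕ.+ x) ≡ + 1
  ^-even x = ≡.trans (ℤ.^-distribˡ-+-* s x x) (^-square x)

  ^-parity : ∀ i j x → i ℕ.+ j ≡ x ℕ.+ x → s ^ i ≡ s ^ j
  ^-parity i j x i+j≡x+x = begin
    s ^ i                        ≡⟨ ℤ.*-identityʳ (s ^ i) ⟨
    s ^ i * + 1                  ≡⟨ cong (s ^ i *_) (^-square j) ⟨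
    s ^ i * (s ^ j * s ^ j)      ≡⟨ ℤ.*-assoc (s ^ i) (s ^ j) (s ^ j) ⟨
    s ^ i * s ^ j * s ^ j        ≡⟨ cong (_* s ^ j) (ℤ.^-distribˡ-+-* s i j) ⟨
    s ^ (i ℕ.+ j) * s ^ j        ≡⟨ cong (λ e → s ^ e * s ^ j) i+j≡x+x ⟩
    s ^ (x ℕ.+ x) * s ^ j        ≡⟨ cong (_* s ^ j) (^-even x) ⟩
    + 1 * s ^ j                  ≡⟨ ℤ.*-identityˡ (s ^ j) ⟩
    s ^ j                        ∎
    where open ≡.≡-Reasoning

module Theta where

  open import Data.Nat using (_+_; _*_)
  open Series
  open Monomials
  open Products
  open Triangular

  θ⁺ : ℤ → ℕ → ℕ → ℕ → Series
  θ⁺ s b a n = ∑ n (λ j → κ (s ℤ.^ j) ⊛ q^ (b * tri j + a * j))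

  -- The terms of index -(j+1) of Σ_{j ∈ ℤ} s^j q^(b j(j-1)/2 + a j), where d = b - a.
  θ⁻ : ℤ → ℕ → ℕ → ℕ → Series
  θ⁻ s b d n = ∑ n (λ j → κ (s ℤ.^ suc j) ⊛ q^ (b * tri (suc j) + d * suc j))

module TripleProduct (s : ℤ) (s²≡1 : s ℤ.* s ≡ + 1) where

  open import Data.Nat using (_≤_; _<_; _+_; _*_)
  open import Data.Nat.Tactic.RingSolver using (solve-∀)
  open Series
  open Monomials
  open Truncation
  open Products
  open Pochhammer
  open Triangular
  open Sign s s²≡1
  open Theta

  private
    κs⊛κs : κ s ⊛ κ s ≈ 1ₛ
    κs⊛κs = ≈-trans (κ-⊛-κ s s) (≈-reflexive (cong κ s²≡1))

    lowerFactor : ∀ e f → q^ (e + f) ⊕ κ s ⊛ q^ e ≈ κ s ⊛ q^ e ⊛ factor s f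
    lowerFactor e f = ≈-trans
      (⊕-congʳ {x = κ s ⊛ q^ e} (≈-sym (≈-trans (⊛-congʳ κs⊛κs) (≈-trans (⊛-identityˡ _) (q^-+ e f)))))
      (solve 3 (λ k x y → k :* k :* (x :* y) :+ k :* x := k :* x :* (con (+ 1) :+ k :* y))
             ≈-refl (κ s) (q^ e) (q^ f))

    upperFactor : ∀ e f → q^ e ⊕ κ s ⊛ q^ (e + f) ≈ q^ e ⊛ factor s f
    upperFactor e f = ≈-trans (⊕-congˡ {x = q^ e} (⊛-congˡ (≈-sym (q^-+ e f))))
      (solve 3 (λ x k y → x :+ k :* (x :* y) := x :* (con (+ 1) :+ k :* y)) ≈-refl (q^ e) (κ s) (q^ f))

    κ-sign : ∀ x y z w g → x + y + z ≡ w + w → κ (s ℤ.^ x) ⊛ (κ (s ℤ.^ y) ⊛ q^ g) ≈ κ (s ℤ.^ z) ⊛ q^ g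
    κ-sign x y z w g even = ≈-trans (≈-sym (⊛-assoc _ _ _)) (⊛-congʳ (≈-trans (κ-⊛-κ _ _)
      (≈-reflexive (cong κ (≡.trans (≡.sym (ℤ.^-distribˡ-+-* s x y)) (^-parity (x + y) z w even))))))

  -- ∏_{i<2m} (q^c + s q^(b i)) is computed twice: factoring q^c or s q^(b i) out of each factor
  -- gives s^m q^E (-s q^d; q^b)_m (-s q^a; q^b)_m, while the q-binomial theorem expands it as a
  -- sum whose k-th term, multiplied by (q^b; q^b)_2m, is s^k q^E times a theta term modulo q^(E+m).
  module Finite (a′ d′ n : ℕ) where

    a d b c m N E : ℕ
    a = suc a′
    d = suc d′
    b = a + d
    c = b * n + d
    m = suc n
    N = m + m
    E = b * tri m + c * m

    open Gaussian b

    lowerHalf : ∏ m (λ i → q^ c ⊕ κ s ⊛ q^ (b * i)) ≈ κ (s ℤ.^ m) ⊛ q^ (b * tri m) ⊛ poch s b d m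
    lowerHalf = begin
        ∏ m (λ i → q^ c ⊕ κ s ⊛ q^ (b * i))
      ≈⟨ ∏-cong m (λ i i<m → ≈-trans (⊕-congʳ {x = κ s ⊛ q^ (b * i)} (q^-cong (c-split i i<m)))
                                      (lowerFactor (b * i) (b * (n ∸ i) + d))) ⟩
        ∏ m (λ i → κ s ⊛ q^ (b * i) ⊛ factor s (b * (n ∸ i) + d))
      ≈⟨ ≈-trans (∏-⊛ m (λ i → κ s ⊛ q^ (b * i)) (λ i → factor s (b * (n ∸ i) + d)))
                 (⊛-congʳ (∏-⊛ m (λ _ → κ s) (λ i → q^ (b * i)))) ⟩
        κ s ^ₛ m ⊛ ∏ m (λ i → q^ (b * i)) ⊛ ∏ m (λ i → factor s (b * (n ∸ i) + d))
      ≈⟨ ⊛-cong (⊛-cong (κ-^ₛ s m) (∏-q^-linear m)) (≈-sym (∏-reverse m (λ i → factor s (b * i + d)))) ⟩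
        κ (s ℤ.^ m) ⊛ q^ (b * tri m) ⊛ poch s b d m
      ∎
      where
      open SetoidReasoning setoid
      c-split : ∀ i → i < m → c ≡ b * i + (b * (n ∸ i) + d)
      c-split i (s≤s i≤n) = ≡.trans (cong (λ z → b * z + d) (≡.sym (ℕ.m+[n∸m]≡n i≤n))) (distrib b i (n ∸ i) d)
        where
        distrib : ∀ b i r d → b * (i + r) + d ≡ b * i + (b * r + d)
        distrib = solve-∀

    upperHalf : ∏ m (λ i → q^ c ⊕ κ s ⊛ q^ (b * (m + i))) ≈ q^ (c * m) ⊛ poch s b a m
    upperHalf = ≈-trans
      (∏-cong m (λ i _ → ≈-trans (⊕-congˡ {x = q^ c} (⊛-congˡ (q^-cong (exponent a d n i)))) (upperFactor c (b * i + a))))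
      (≈-trans (∏-⊛ m (λ _ → q^ c) (λ i → factor s (b * i + a))) (⊛-congʳ (q^-^ₛ c m)))
      where
      exponent : ∀ a d n i → (a + d) * (suc n + i) ≡ (a + d) * n + d + ((a + d) * i + a)
      exponent = solve-∀

    product : ∏ N (λ i → q^ c ⊕ κ s ⊛ q^ (b * i)) ≈ κ (s ℤ.^ m) ⊛ q^ E ⊛ (poch s b d m ⊛ poch s b a m)
    product = begin
        ∏ N (λ i → q^ c ⊕ κ s ⊛ q^ (b * i))
      ≈⟨ ∏-+ m m (λ i → q^ c ⊕ κ s ⊛ q^ (b * i)) ⟩
        ∏ m (λ i → q^ c ⊕ κ s ⊛ q^ (b * i)) ⊛ ∏ m (λ i → q^ c ⊕ κ s ⊛ q^ (b * (m + i)))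
      ≈⟨ ⊛-cong lowerHalf upperHalf ⟩
        κ (s ℤ.^ m) ⊛ q^ (b * tri m) ⊛ poch s b d m ⊛ (q^ (c * m) ⊛ poch s b a m)
      ≈⟨ solve 5 (λ k x p y p′ → k :* x :* p :* (y :* p′) := k :* (x :* y) :* (p :* p′)) ≈-refl
               (κ (s ℤ.^ m)) (q^ (b * tri m)) (poch s b d m) (q^ (c * m)) (poch s b a m) ⟩
        κ (s ℤ.^ m) ⊛ (q^ (b * tri m) ⊛ q^ (c * m)) ⊛ (poch s b d m ⊛ poch s b a m)
      ≈⟨ ⊛-congʳ (⊛-congˡ (q^-+ (b * tri m) (c * m))) ⟩
        κ (s ℤ.^ m) ⊛ q^ E ⊛ (poch s b d m ⊛ poch s b a m)
      ∎
      where open SetoidReasoning setoid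

    W : Series
    W = qfac b N

    term : ℕ → Series
    term = binomialTerm N (q^ c) (κ s)

    gA gD : ℕ → ℕ
    gA j = b * tri j + a * j
    gD j = b * tri (suc j) + d * suc j

    exponent-upper : ∀ j → j ≤ m → b * tri (m + j) + c * (N ∸ (m + j)) ≡ E + gA j
    exponent-upper j j≤m = begin
        b * tri (m + j) + c * (N ∸ (m + j))
      ≡⟨ cong₂ (λ t r → b * t + c * r) (tri-+ m j) (ℕ.[m+n]∸[m+o]≡n∸o m m j) ⟩
        b * (tri m + tri j + m * j) + c * (m ∸ j)
      ≡⟨ identity a d n j (m ∸ j) (tri m) (tri j) ⟩
        b * tri m + c * (j + (m ∸ j)) + gA j
      ≡⟨ cong (λ z → b * tri m + c * z + gA j) (ℕ.m+[n∸m]≡n j≤m) ⟩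
        E + gA j
      ∎
      where
      open ≡.≡-Reasoning
      identity : ∀ a d n j l tm tj → (a + d) * (tm + tj + suc n * j) + ((a + d) * n + d) * l
                                     ≡ (a + d) * tm + ((a + d) * n + d) * (j + l) + ((a + d) * tj + a * j)
      identity = solve-∀

    exponent-lower : ∀ j → j < m → b * tri (m ∸ suc j) + c * (N ∸ (m ∸ suc j)) ≡ E + gD j
    exponent-lower j j<m@(s≤s j≤n) = begin
        b * tri r + c * (N ∸ r)
      ≡⟨ cong (λ z → b * tri r + c * z) N∸r≡m+1+j ⟩
        b * tri r + c * (m + suc j)
      ≡⟨ cong (λ z → b * tri r + (b * z + d) * (m + suc j)) n≡r+j ⟩
        b * tri r + (b * (r + j) + d) * (m + suc j)
      ≡⟨ lhs b d r j (tri r) m ⟩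
        P + b * (suc j * j)
      ≡⟨ cong (λ z → P + b * z) (tri-suc-double j) ⟨
        P + b * (tri (suc j) + tri (suc j))
      ≡⟨ rhs b d r j (tri r) (tri (suc j)) m ⟨
        b * (tri r + tri (suc j) + r * suc j) + (b * (r + j) + d) * m + gD j
      ≡⟨ cong₂ (λ t z → b * t + (b * z + d) * m + gD j) (≡.sym tri-m) (≡.sym n≡r+j) ⟩
        E + gD j
      ∎
      where
      open ≡.≡-Reasoning
      r : ℕ
      r = m ∸ suc j
      n≡r+j : n ≡ r + j
      n≡r+j = ≡.sym (ℕ.m∸n+n≡m j≤n)
      tri-m : tri m ≡ tri r + tri (suc j) + r * suc j
      tri-m = ≡.trans (cong (tri ∘ suc) n≡r+j) (≡.trans (cong tri (≡.sym (ℕ.+-suc r j))) (tri-+ r (suc j)))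
      N∸r≡m+1+j : N ∸ r ≡ m + suc j
      N∸r≡m+1+j = ≡.trans (ℕ.+-∸-assoc m (ℕ.m∸n≤m m (suc j))) (cong (_+_ m) (ℕ.m∸[m∸n]≡n j<m))
      P : ℕ
      P = b * tri r + (b * (r + j) + d) * m + b * r * suc j + d * suc j
      lhs : ∀ b d r j tr m → b * tr + (b * (r + j) + d) * (m + suc j)
                             ≡ b * tr + (b * (r + j) + d) * m + b * r * suc j + d * suc j + b * (suc j * j)
      lhs = solve-∀
      rhs : ∀ b d r j tr t m → b * (tr + t + r * suc j) + (b * (r + j) + d) * m + (b * t + d * suc j)
                               ≡ b * tr + (b * (r + j) + d) * m + b * r * suc j + d * suc j + b * (t + t)
      rhs = solve-∀

    term-collect : ∀ k → term k ≈ κ (s ℤ.^ k) ⊛ q^ (b * tri k + c * (N ∸ k)) ⊛ gauss N k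
    term-collect k = begin
        gauss N k ⊛ q^ (b * tri k) ⊛ κ s ^ₛ k ⊛ q^ c ^ₛ (N ∸ k)
      ≈⟨ ⊛-cong (⊛-congˡ (κ-^ₛ s k)) (q^-^ₛ c (N ∸ k)) ⟩
        gauss N k ⊛ q^ (b * tri k) ⊛ κ (s ℤ.^ k) ⊛ q^ (c * (N ∸ k))
      ≈⟨ solve 4 (λ g x k y → g :* x :* k :* y := k :* (x :* y) :* g) ≈-refl
               (gauss N k) (q^ (b * tri k)) (κ (s ℤ.^ k)) (q^ (c * (N ∸ k))) ⟩
        κ (s ℤ.^ k) ⊛ (q^ (b * tri k) ⊛ q^ (c * (N ∸ k))) ⊛ gauss N k
      ≈⟨ ⊛-congʳ (⊛-congˡ (q^-+ (b * tri k) (c * (N ∸ k)))) ⟩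
        κ (s ℤ.^ k) ⊛ q^ (b * tri k + c * (N ∸ k)) ⊛ gauss N k
      ∎
      where open SetoidReasoning setoid

    W⊛term : ∀ k g {M} → k ≤ N → b * tri k + c * (N ∸ k) ≡ E + g →
             M ∸ g ≤ b * suc k → M ∸ g ≤ b * suc (N ∸ k) →
             W ⊛ term k ≈[ E + M ] q^ E ⊛ (κ (s ℤ.^ k) ⊛ q^ g)
    W⊛term k g {M} k≤N exponent M∸g≤₁ M∸g≤₂ = begin
        W ⊛ term k
      ≈⟨ ≈⇒≈[] (⊛-congˡ (≈-trans (term-collect k)
                                  (⊛-congʳ (⊛-congˡ (≈-trans (q^-cong exponent) (≈-sym (q^-+ E g))))))) ⟩
        W ⊛ (κ (s ℤ.^ k) ⊛ (q^ E ⊛ q^ g) ⊛ gauss N k)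
      ≈⟨ ≈⇒≈[] (≈-trans (solve 5 (λ w k e x y → w :* (k :* (e :* x) :* y) := e :* (k :* (x :* (y :* w)))) ≈-refl
                                  W (κ (s ℤ.^ k)) (q^ E) (q^ g) (gauss N k))
                         (q^-⊛ E _)) ⟩
        shift E (κ (s ℤ.^ k) ⊛ (q^ g ⊛ (gauss N k ⊛ W)))
      ≈⟨ shift-cong-≈[] E (⊛-cong-≈[] ≈[]-refl (≈[]-mono (ℕ.m≤n+m∸n M g) q^g⊛gauss⊛W)) ⟩
        shift E (κ (s ℤ.^ k) ⊛ q^ g)
      ≈⟨ ≈⇒≈[] (q^-⊛ E _) ⟨
        q^ E ⊛ (κ (s ℤ.^ k) ⊛ q^ g)
      ∎
      where
      open ≈[]-Reasoning (E + M)
      q^g⊛gauss⊛W : q^ g ⊛ (gauss N k ⊛ W) ≈[ g + (M ∸ g) ] q^ g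
      q^g⊛gauss⊛W = ≈[]-trans (≈⇒≈[] (q^-⊛ g _))
        (shift-cong-≈[] g (gauss⊛qfac≈[]1 N k k≤N M∸g≤₁ M∸g≤₂))

    private
      ≤b* : ∀ {x y} → x ≤ y → x ≤ b * suc y
      ≤b* x≤y = ℕ.≤-trans (ℕ.m≤n⇒m≤1+n x≤y) (ℕ.m≤n*m _ b)

    W⊛upperTerm : ∀ M → M ≤ m → ∀ j → j ≤ m →
                  W ⊛ term (m + j) ≈[ E + M ] q^ E ⊛ (κ (s ℤ.^ (m + j)) ⊛ q^ (gA j))
    W⊛upperTerm M M≤m j j≤m = W⊛term (m + j) (gA j) (ℕ.+-monoʳ-≤ m j≤m) (exponent-upper j j≤m)
      (≤b* (ℕ.≤-trans (ℕ.m∸n≤m M (gA j)) (ℕ.≤-trans M≤m (ℕ.m≤m+n m j))))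
      (≤b* (ℕ.≤-trans (ℕ.∸-monoʳ-≤ M j≤gA) (ℕ.≤-trans (ℕ.∸-monoˡ-≤ j M≤m)
                                          (ℕ.≤-reflexive (≡.sym (ℕ.[m+n]∸[m+o]≡n∸o m m j))))))
      where
      j≤gA : j ≤ gA j
      j≤gA = ℕ.≤-trans (ℕ.m≤n*m j a) (ℕ.m≤n+m (a * j) (b * tri j))

    W⊛lowerTerm : ∀ M → M ≤ m → ∀ j → j < m →
                  W ⊛ term (m ∸ suc j) ≈[ E + M ] q^ E ⊛ (κ (s ℤ.^ (m ∸ suc j)) ⊛ q^ (gD j))
    W⊛lowerTerm M M≤m j j<m = W⊛term (m ∸ suc j) (gD j) (ℕ.≤-trans (ℕ.m∸n≤m m (suc j)) (ℕ.m≤m+n m m))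
      (exponent-lower j j<m)
      (≤b* (ℕ.≤-trans (ℕ.∸-monoʳ-≤ M 1+j≤gD) (ℕ.∸-monoˡ-≤ (suc j) M≤m)))
      (≤b* (ℕ.≤-trans (ℕ.m∸n≤m M (gD j)) (ℕ.≤-trans M≤m
             (ℕ.≤-trans (ℕ.≤-reflexive (≡.sym (ℕ.m+n∸m≡n m m))) (ℕ.∸-monoʳ-≤ N (ℕ.m∸n≤m m (suc j)))))))
      where
      1+j≤gD : suc j ≤ gD j
      1+j≤gD = ℕ.≤-trans (ℕ.m≤n*m (suc j) d) (ℕ.m≤n+m (d * suc j) (b * tri (suc j)))

    binomialExpansion : q^ E ⊛ (κ (s ℤ.^ m) ⊛ (poch s b d m ⊛ poch s b a m ⊛ W))
                        ≈ ∑ m (λ j → W ⊛ term (m ∸ suc j)) ⊕ ∑ (suc m) (λ j → W ⊛ term (m + j))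
    binomialExpansion = begin
        q^ E ⊛ (κ (s ℤ.^ m) ⊛ (poch s b d m ⊛ poch s b a m ⊛ W))
      ≈⟨ solve 5 (λ x k p p′ w → x :* (k :* (p :* p′ :* w)) := k :* x :* (p :* p′) :* w) ≈-refl
               (q^ E) (κ (s ℤ.^ m)) (poch s b d m) (poch s b a m) W ⟩
        κ (s ℤ.^ m) ⊛ q^ E ⊛ (poch s b d m ⊛ poch s b a m) ⊛ W
      ≈⟨ ⊛-congʳ (≈-trans (≈-sym product) (qBinomial N (q^ c) (κ s))) ⟩
        ∑ (suc N) term ⊛ W
      ≈⟨ ≈-trans (⊛-comm _ W) (⊛-∑ (suc N) W term) ⟩
        ∑ (suc N) (λ k → W ⊛ term k)
      ≈⟨ ≈-reflexive (cong (λ l → ∑ l (λ k → W ⊛ term k)) (≡.sym (ℕ.+-suc m m))) ⟩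
        ∑ (m + suc m) (λ k → W ⊛ term k)
      ≈⟨ ≈-trans (∑-+ m (suc m) (λ k → W ⊛ term k))
                 (⊕-congʳ {x = ∑ (suc m) (λ j → W ⊛ term (m + j))} (∑-reverse m (λ k → W ⊛ term k))) ⟩
        ∑ m (λ j → W ⊛ term (m ∸ suc j)) ⊕ ∑ (suc m) (λ j → W ⊛ term (m + j))
      ∎
      where open SetoidReasoning setoid

    upperT lowerT : ℕ → Series
    upperT j = κ (s ℤ.^ (m + j)) ⊛ q^ (gA j)
    lowerT j = κ (s ℤ.^ (m ∸ suc j)) ⊛ q^ (gD j)

    tripleProductShifted : ∀ M → M ≤ m →
      κ (s ℤ.^ m) ⊛ (poch s b d m ⊛ poch s b a m ⊛ W) ≈[ M ] ∑ m lowerT ⊕ ∑ (suc m) upperT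
    tripleProductShifted M M≤m = shift-cancel-≈[] E (begin
        shift E (κ (s ℤ.^ m) ⊛ (poch s b d m ⊛ poch s b a m ⊛ W))
      ≈⟨ ≈⇒≈[] (≈-trans (≈-sym (q^-⊛ E _)) binomialExpansion) ⟩
        ∑ m (λ j → W ⊛ term (m ∸ suc j)) ⊕ ∑ (suc m) (λ j → W ⊛ term (m + j))
      ≈⟨ ⊕-cong-≈[] (∑-cong-≈[] m (λ j j<m → W⊛lowerTerm M M≤m j j<m))
                    (∑-cong-≈[] (suc m) (λ j j<1+m → W⊛upperTerm M M≤m j (ℕ.≤-pred j<1+m))) ⟩
        ∑ m (λ j → q^ E ⊛ lowerT j) ⊕ ∑ (suc m) (λ j → q^ E ⊛ upperT j)
      ≈⟨ ≈⇒≈[] (≈-trans (≈-sym (⊕-cong (⊛-∑ m (q^ E) lowerT) (⊛-∑ (suc m) (q^ E) upperT)))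
                        (≈-trans (≈-sym (⊛-distribˡ (q^ E) _ _)) (q^-⊛ E _))) ⟩
        shift E (∑ m lowerT ⊕ ∑ (suc m) upperT)
      ∎)
      where open ≈[]-Reasoning (E + M)

    tripleProductBelow : ∀ M → M ≤ m →
      poch s b d m ⊛ poch s b a m ⊛ W ≈[ M ] θ⁺ s b a (suc m) ⊕ θ⁻ s b d m
    tripleProductBelow M M≤m = begin
        Z
      ≈⟨ ≈⇒≈[] (≈-sym (≈-trans (≈-sym (⊛-assoc σ σ Z))
                 (≈-trans (⊛-congʳ (≈-trans (κ-⊛-κ _ _) (≈-reflexive (cong κ (^-square m))))) (⊛-identityˡ Z)))) ⟩
        σ ⊛ (σ ⊛ Z)
      ≈⟨ ⊛-cong-≈[] ≈[]-refl (tripleProductShifted M M≤m) ⟩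
        σ ⊛ (∑ m lowerT ⊕ ∑ (suc m) upperT)
      ≈⟨ ≈⇒≈[] (≈-trans (⊛-distribˡ σ _ _) (≈-trans (⊕-cong (⊛-∑ m σ lowerT) (⊛-∑ (suc m) σ upperT))
                 (≈-trans (⊕-cong (∑-cong m λ j j<m → κ-sign m (m ∸ suc j) (suc j) m (gD j) (lower-parity j j<m))
                                  (∑-cong (suc m) λ j _ → κ-sign m (m + j) j (m + j) (gA j) (upper-parity j)))
                          (⊕-comm (θ⁻ s b d m) (θ⁺ s b a (suc m)))))) ⟩
        θ⁺ s b a (suc m) ⊕ θ⁻ s b d m
      ∎
      where
      open ≈[]-Reasoning M
      σ Z : Series
      σ = κ (s ℤ.^ m)
      Z = poch s b d m ⊛ poch s b a m ⊛ W
      upper-parity : ∀ j → m + (m + j) + j ≡ m + j + (m + j)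
      upper-parity j = parity m j
        where
        parity : ∀ m j → m + (m + j) + j ≡ m + j + (m + j)
        parity = solve-∀
      lower-parity : ∀ j → j < m → m + (m ∸ suc j) + suc j ≡ m + m
      lower-parity j j<m = ≡.trans (ℕ.+-assoc m (m ∸ suc j) (suc j)) (cong (_+_ m) (ℕ.m∸n+n≡m j<m))

  tripleProduct : ∀ a′ d′ M → let a = suc a′; d = suc d′; b = a + d in
    poch s b d M ⊛ poch s b a M ⊛ qfac b M ≈[ M ] θ⁺ s b a (suc (suc M)) ⊕ θ⁻ s b d (suc M)
  tripleProduct a′ d′ M = ≈[]-trans
    (⊛-cong-≈[] (⊛-cong-≈[] (≈[]-sym (poch-≈[] s b d M≤m)) (≈[]-sym (poch-≈[] s b a M≤m)))
                (≈[]-sym (poch-≈[] -1ℤ b b (ℕ.≤-trans M≤m (ℕ.m≤m+n m m)))))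
    (tripleProductBelow M M≤m)
    where
    open Finite a′ d′ M
    M≤m : M ≤ m
    M≤m = ℕ.n≤1+n M

module Twist where

  open import Data.Integer using (_+_; _*_; -_; _^_)
  open import Data.Integer.Tactic.RingSolver using (solve-∀)
  open Series
  open Monomials
  open Truncation
  open Products
  open Pochhammer
  open Sign -1ℤ refl

  σ : Series → Series
  σ f n = -1ℤ ^ n * f n

  σ-≈[] : ∀ {f g M} → f ≈[ M ] g → σ f ≈[ M ] σ g
  σ-≈[] p = mk≈[] (λ n n<M → cong (-1ℤ ^ n *_) (below p n n<M))

  σ-⊛ : ∀ f g → σ (f ⊛ g) ≈ σ f ⊛ σ g
  σ-⊛ f g = mk≈ (go f g)
    where
    go : ∀ f g → σ (f ⊛ g) ≗ σ f ⊛ σ g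
    go f g zero    = ≡.trans (ℤ.*-identityˡ _) (≡.sym (cong₂ _*_ (ℤ.*-identityˡ (f 0)) (ℤ.*-identityˡ (g 0))))
    go f g (suc n) = ≡.sym (begin
        + 1 * f 0 * (-1ℤ * -1ℤ ^ n * g (suc n)) + ((σ f ∘ suc) ⊛ σ g) n
      ≡⟨ cong (_+_ (+ 1 * f 0 * (-1ℤ * -1ℤ ^ n * g (suc n))))
              (at (⊛-cong (mk≈ (λ i → sign-suc (-1ℤ ^ i) (f (suc i)))) (≈-refl {σ g})) n) ⟩
        + 1 * f 0 * (-1ℤ * -1ℤ ^ n * g (suc n)) + ((⊝ σ (f ∘ suc)) ⊛ σ g) n
      ≡⟨ cong (_+_ (+ 1 * f 0 * (-1ℤ * -1ℤ ^ n * g (suc n))))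
              (≡.trans (at (solve 2 (λ f g → (:- f) :* g := :- (f :* g)) ≈-refl (σ (f ∘ suc)) (σ g)) n)
                       (cong -_ (≡.sym (go (f ∘ suc) g n)))) ⟩
        + 1 * f 0 * (-1ℤ * -1ℤ ^ n * g (suc n)) + - (-1ℤ ^ n * ((f ∘ suc) ⊛ g) n)
      ≡⟨ collect (-1ℤ ^ n) (f 0) (g (suc n)) (((f ∘ suc) ⊛ g) n) ⟩
        -1ℤ * -1ℤ ^ n * (f 0 * g (suc n) + ((f ∘ suc) ⊛ g) n)
      ∎)
      where
      open ≡.≡-Reasoning
      sign-suc : ∀ a b → -1ℤ * a * b ≡ - (a * b)
      sign-suc = solve-∀
      collect : ∀ a x y z → + 1 * x * (-1ℤ * a * y) + - (a * z) ≡ -1ℤ * a * (x * y + z)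
      collect = solve-∀

  σ-1 : σ 1ₛ ≈ 1ₛ
  σ-1 = mk≈ λ { zero → refl ; (suc n) → ℤ.*-zeroʳ (-1ℤ ^ suc n) }

  σ-∏ : ∀ n f → σ (∏ n f) ≈ ∏ n (σ ∘ f)
  σ-∏ zero    f = σ-1
  σ-∏ (suc n) f = ≈-trans (σ-⊛ (f 0) _) (⊛-congˡ (σ-∏ n (f ∘ suc)))

  σ-shift : ∀ e f → σ (shift e f) ≈ -1ℤ ^ e · shift e (σ f)
  σ-shift zero    f = mk≈ (λ n → ≡.sym (ℤ.*-identityˡ _))
  σ-shift (suc e) f = mk≈ λ
    { zero    → ≡.trans (ℤ.*-zeroʳ (+ 1)) (≡.sym (ℤ.*-zeroʳ (-1ℤ ^ suc e)))
    ; (suc n) → ≡.trans (ℤ.*-assoc -1ℤ (-1ℤ ^ n) _)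
                  (≡.trans (cong (-1ℤ *_) (at (σ-shift e f) n)) (≡.sym (ℤ.*-assoc -1ℤ (-1ℤ ^ e) _))) }

  σ-factor : ∀ s e → σ (factor s e) ≈ factor (s * -1ℤ ^ e) e
  σ-factor s e = mk≈ λ n → begin
      -1ℤ ^ n * (1ₛ n + (κ s ⊛ q^ e) n)
    ≡⟨ ℤ.*-distribˡ-+ (-1ℤ ^ n) (1ₛ n) _ ⟩
      σ 1ₛ n + -1ℤ ^ n * (κ s ⊛ q^ e) n
    ≡⟨ cong₂ _+_ (at σ-1 n) (cong (-1ℤ ^ n *_) (at (κ-⊛ s (q^ e)) n)) ⟩
      1ₛ n + -1ℤ ^ n * (s * (q^ e) n)
    ≡⟨ cong (_+_ (1ₛ n)) (swap (-1ℤ ^ n) s ((q^ e) n)) ⟩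
      1ₛ n + s * σ (q^ e) n
    ≡⟨ cong (λ z → 1ₛ n + s * z) (≡.trans (at (σ-shift e 1ₛ) n) (cong (-1ℤ ^ e *_) (at (shift-cong e σ-1) n))) ⟩
      1ₛ n + s * (-1ℤ ^ e * (q^ e) n)
    ≡⟨ cong (_+_ (1ₛ n)) (≡.trans (≡.sym (ℤ.*-assoc s _ _)) (≡.sym (at (κ-⊛ (s * -1ℤ ^ e) (q^ e)) n))) ⟩
      1ₛ n + (κ (s * -1ℤ ^ e) ⊛ q^ e) n
    ∎
    where
    open ≡.≡-Reasoning
    swap : ∀ a b c → a * (b * c) ≡ b * (a * c)
    swap = solve-∀

  σ-poch-even : ∀ s u v n → σ (poch s (2 ℕ.* u) v n) ≈ poch (s * -1ℤ ^ v) (2 ℕ.* u) v n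
  σ-poch-even s u v n = ≈-trans (σ-∏ n _) (∏-cong n λ i _ →
    ≈-trans (σ-factor s (2 ℕ.* u ℕ.* i ℕ.+ v))
            (≈-reflexive (cong (λ t → factor (s * t) (2 ℕ.* u ℕ.* i ℕ.+ v)) (^-parity _ v (u ℕ.* i ℕ.+ v) (even u i v)))))
    where
    open import Data.Nat.Tactic.RingSolver using () renaming (solve-∀ to solve-ℕ)
    even : ∀ u i v → 2 ℕ.* u ℕ.* i ℕ.+ v ℕ.+ v ≡ u ℕ.* i ℕ.+ v ℕ.+ (u ℕ.* i ℕ.+ v)
    even = solve-ℕ

module Identities where

  open import Data.Nat using (_+_; _*_)
  open import Data.Nat.Tactic.RingSolver using (solve-∀)
  open Series
  open Monomials
  open Truncation
  open Products
  open Pochhammer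
  open Theta
  open Twist

  poch-dissect₂ : ∀ s u v M .{{_ : ℕ.NonZero u}} →
    poch s u v M ≈[ M ] poch s (2 * u) v M ⊛ poch s (2 * u) (u + v) M
  poch-dissect₂ s u v M = ≈[]-trans (≈[]-sym (poch-≈[] s u v (ℕ.m≤m*n M 2))) (≈⇒≈[] (≈-trans (poch-dissect s u v 2 M)
    (⊛-cong (≈-reflexive (cong (λ w → poch s (2 * u) w M) (cong (_+ v) (ℕ.*-zeroʳ u))))
            (≈-trans (⊛-identityʳ _) (≈-reflexive (cong (λ w → poch s (2 * u) w M) (cong (_+ v) (ℕ.*-identityʳ u))))))))

  poch-dissect₃ : ∀ s u v M .{{_ : ℕ.NonZero u}} →
    poch s u v M ≈[ M ] poch s (3 * u) v M ⊛ poch s (3 * u) (u + v) M ⊛ poch s (3 * u) (2 * u + v) M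
  poch-dissect₃ s u v M = ≈[]-trans (≈[]-sym (poch-≈[] s u v (ℕ.m≤m*n M 3))) (≈⇒≈[] (≈-trans (poch-dissect s u v 3 M)
    (≈-trans (⊛-congˡ (⊛-congˡ (⊛-identityʳ _))) (≈-trans (≈-sym (⊛-assoc _ _ _))
      (⊛-cong (⊛-cong (P (ℕ.*-zeroʳ u)) (P (ℕ.*-identityʳ u))) (P (ℕ.*-comm u 2)))))))
    where
    P : ∀ {w w′} → w ≡ w′ → poch s (3 * u) (w + v) M ≈ poch s (3 * u) (w′ + v) M
    P = ≈-reflexive ∘ cong (λ w → poch s (3 * u) (w + v) M)

  euler : ∀ u M .{{_ : ℕ.NonZero u}} → poch (+ 1) u u M ⊛ poch -1ℤ (2 * u) u M ≈[ M ] 1ₛ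
  euler u M = cancel-≈[] C (poch-constant-term -1ℤ (2 * u) M (ℕ.<-≤-trans (ℕ.>-nonZero⁻¹ u) (ℕ.m≤m+n u u))) (begin
      C ⊛ (A ⊛ B)                       ≈⟨ ≈⇒≈[] (solve 3 (λ c a b → c :* (a :* b) := a :* (b :* c)) ≈-refl C A B) ⟩
      A ⊛ (B ⊛ C)                       ≈⟨ ⊛-cong-≈[] ≈[]-refl (poch-dissect₂ -1ℤ u u M) ⟨
      A ⊛ poch -1ℤ u u M                ≈⟨ ≈⇒≈[] (≈-trans (≈-sym (∏-⊛ M _ _)) (∏-cong M λ i _ →
                                             ≈-trans (difference-of-squares (u * i + u)) (factor-cong -1ℤ (exponent u i)))) ⟩
      C                                 ≈⟨ ≈⇒≈[] (⊛-identityʳ C) ⟨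
      C ⊛ 1ₛ                            ∎)
    where
    open ≈[]-Reasoning M
    A B C : Series
    A = poch (+ 1) u u M
    B = poch -1ℤ (2 * u) u M
    C = poch -1ℤ (2 * u) (u + u) M
    exponent : ∀ u i → u * i + u + (u * i + u) ≡ 2 * u * i + (u + u)
    exponent = solve-∀
    difference-of-squares : ∀ e → factor (+ 1) e ⊛ factor -1ℤ e ≈ factor -1ℤ (e + e)
    difference-of-squares e = ≈-trans
      (solve 1 (λ x → (con (+ 1) :+ con (+ 1) :* x) :* (con (+ 1) :+ con -1ℤ :* x) := con (+ 1) :+ con -1ℤ :* (x :* x))
             ≈-refl (q^ e))
      (⊕-congˡ {x = 1ₛ} (⊛-congˡ (q^-+ e e)))

  distinctParts : ℕ → Series
  distinctParts M = poch (+ 1) 1 1 M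

  thetaSquares : ℕ → ℕ → Series
  thetaSquares c M = θ⁺ -1ℤ (c + c) c (suc (suc M)) ⊕ θ⁻ -1ℤ (c + c) c (suc M)

  pentagonalSeries : ℤ → ℕ → Series
  pentagonalSeries s M = θ⁺ s 3 1 (suc (suc M)) ⊕ θ⁻ s 3 2 (suc M)

  private
    module Jacobi₋ = TripleProduct -1ℤ refl
    module Jacobi₊ = TripleProduct (+ 1) refl

  pentagonalNumberTheorem : ∀ M → poch -1ℤ 1 1 M ≈[ M ] pentagonalSeries -1ℤ M
  pentagonalNumberTheorem M = begin
    poch -1ℤ 1 1 M                              ≈⟨ poch-dissect₃ -1ℤ 1 1 M ⟩
    poch -1ℤ 3 1 M ⊛ poch -1ℤ 3 2 M ⊛ qfac 3 M   ≈⟨ ≈⇒≈[] (⊛-congʳ (⊛-comm _ _)) ⟩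
    poch -1ℤ 3 2 M ⊛ poch -1ℤ 3 1 M ⊛ qfac 3 M   ≈⟨ Jacobi₋.tripleProduct 0 1 M ⟩
    pentagonalSeries -1ℤ M                      ∎
    where open ≈[]-Reasoning M

  distinctParts⊛thetaSquares₁ : ∀ M → distinctParts M ⊛ thetaSquares 1 M ≈[ M ] pentagonalSeries -1ℤ M
  distinctParts⊛thetaSquares₁ M = begin
      Qₛ ⊛ thetaSquares 1 M
    ≈⟨ ⊛-cong-≈[] ≈[]-refl (Jacobi₋.tripleProduct 0 0 M) ⟨
      Qₛ ⊛ (P₂₁ ⊛ P₂₁ ⊛ qfac 2 M)
    ≈⟨ ≈⇒≈[] (solve 3 (λ q x y → q :* (x :* x :* y) := q :* x :* (x :* y)) ≈-refl Qₛ P₂₁ (qfac 2 M)) ⟩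
      Qₛ ⊛ P₂₁ ⊛ (P₂₁ ⊛ qfac 2 M)
    ≈⟨ ⊛-cong-≈[] (euler 1 M) (≈[]-sym (poch-dissect₂ -1ℤ 1 1 M)) ⟩
      1ₛ ⊛ poch -1ℤ 1 1 M
    ≈⟨ ≈⇒≈[] (⊛-identityˡ _) ⟩
      poch -1ℤ 1 1 M
    ≈⟨ pentagonalNumberTheorem M ⟩
      pentagonalSeries -1ℤ M
    ∎
    where
    open ≈[]-Reasoning M
    Qₛ P₂₁ : Series
    Qₛ = distinctParts M
    P₂₁ = poch -1ℤ 2 1 M

  distinctParts⊛thetaSquares₂ : ∀ M → distinctParts M ⊛ thetaSquares 2 M ≈[ M ] σ (pentagonalSeries -1ℤ M)
  distinctParts⊛thetaSquares₂ M = begin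
      distinctParts M ⊛ thetaSquares 2 M
    ≈⟨ ⊛-cong-≈[] (poch-dissect₂ (+ 1) 1 1 M) (≈[]-sym (Jacobi₋.tripleProduct 1 1 M)) ⟩
      R₂₁ ⊛ R₂₂ ⊛ (P₄₂ ⊛ P₄₂ ⊛ qfac 4 M)
    ≈⟨ ≈⇒≈[] (solve 4 (λ a b x y → a :* b :* (x :* x :* y) := a :* (b :* x) :* (x :* y))
                      ≈-refl R₂₁ R₂₂ P₄₂ (qfac 4 M)) ⟩
      R₂₁ ⊛ (R₂₂ ⊛ P₄₂) ⊛ (P₄₂ ⊛ qfac 4 M)
    ≈⟨ ⊛-cong-≈[] (⊛-cong-≈[] ≈[]-refl (euler 2 M)) (≈[]-sym (poch-dissect₂ -1ℤ 2 2 M)) ⟩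
      R₂₁ ⊛ 1ₛ ⊛ qfac 2 M
    ≈⟨ ≈⇒≈[] (⊛-congʳ (⊛-identityʳ R₂₁)) ⟩
      R₂₁ ⊛ qfac 2 M
    ≈⟨ ≈⇒≈[] (≈-trans (σ-⊛ _ _) (⊛-cong (σ-poch-even -1ℤ 1 1 M) (σ-poch-even -1ℤ 1 2 M))) ⟨
      σ (poch -1ℤ 2 1 M ⊛ qfac 2 M)
    ≈⟨ σ-≈[] (≈[]-sym (poch-dissect₂ -1ℤ 1 1 M)) ⟩
      σ (poch -1ℤ 1 1 M)
    ≈⟨ σ-≈[] (pentagonalNumberTheorem M) ⟩
      σ (pentagonalSeries -1ℤ M)
    ∎
    where
    open ≈[]-Reasoning M
    R₂₁ R₂₂ P₄₂ : Series
    R₂₁ = poch (+ 1) 2 1 M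
    R₂₂ = poch (+ 1) 2 2 M
    P₄₂ = poch -1ℤ 4 2 M

  distinctParts⊛thetaSquares₃ : ∀ M → distinctParts M ⊛ thetaSquares 3 M ≈[ M ] pentagonalSeries (+ 1) M
  distinctParts⊛thetaSquares₃ M = begin
      distinctParts M ⊛ thetaSquares 3 M
    ≈⟨ ⊛-cong-≈[] (poch-dissect₃ (+ 1) 1 1 M) (≈[]-sym (Jacobi₋.tripleProduct 2 2 M)) ⟩
      R₃₁ ⊛ R₃₂ ⊛ R₃₃ ⊛ (P₆₃ ⊛ P₆₃ ⊛ qfac 6 M)
    ≈⟨ ≈⇒≈[] (solve 5 (λ a b c x y → a :* b :* c :* (x :* x :* y) := b :* a :* (c :* x) :* (x :* y)) ≈-refl
                    R₃₁ R₃₂ R₃₃ P₆₃ (qfac 6 M)) ⟩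
      R₃₂ ⊛ R₃₁ ⊛ (R₃₃ ⊛ P₆₃) ⊛ (P₆₃ ⊛ qfac 6 M)
    ≈⟨ ⊛-cong-≈[] (⊛-cong-≈[] ≈[]-refl (euler 3 M)) (≈[]-sym (poch-dissect₂ -1ℤ 3 3 M)) ⟩
      R₃₂ ⊛ R₃₁ ⊛ 1ₛ ⊛ qfac 3 M
    ≈⟨ ≈⇒≈[] (⊛-congʳ (⊛-identityʳ _)) ⟩
      R₃₂ ⊛ R₃₁ ⊛ qfac 3 M
    ≈⟨ Jacobi₊.tripleProduct 0 1 M ⟩
      pentagonalSeries (+ 1) M
    ∎
    where
    open ≈[]-Reasoning M
    R₃₁ R₃₂ R₃₃ P₆₃ : Series
    R₃₁ = poch (+ 1) 3 1 M
    R₃₂ = poch (+ 1) 3 2 M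
    R₃₃ = poch (+ 1) 3 3 M
    P₆₃ = poch -1ℤ 6 3 M

module Pentagonal where

  open import Data.Nat using (_≤_; _<_; _+_; _*_; _≟_; _≤?_)
  open import Data.Nat.DivMod using (_/_; /-congˡ; m*n/n≡m; +-distrib-/-∣ʳ; m/n≤m)
  open import Data.Nat.Divisibility using (divides-refl)
  open import Data.Nat.Tactic.RingSolver using (solve-∀)
  open import Relation.Binary.Definitions using (tri<; tri≈; tri>)
  open Triangular

  T≡tri : ∀ x → T x ≡ tri (suc x)
  T≡tri x = ≡.trans (/-congˡ (≡.trans (ℕ.*-comm x (suc x)) (≡.trans (≡.sym (tri-suc-double x)) (double (tri (suc x))))))
                    (m*n/n≡m (tri (suc x)) 2)
    where
    double : ∀ t → t + t ≡ t * 2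
    double = solve-∀

  tri-double : ∀ k → tri (k + k) ≡ 4 * tri k + k
  tri-double zero    = refl
  tri-double (suc j) = begin
    tri (suc j + suc j)                          ≡⟨ tri-+ (suc j) (suc j) ⟩
    t + t + suc j * suc j                        ≡⟨ cong (λ x → t + t + x) (ℕ.*-suc (suc j) j) ⟩
    t + t + (suc j + suc j * j)                  ≡⟨ cong (λ x → t + t + (suc j + x)) (tri-suc-double j) ⟨
    t + t + (suc j + (t + t))                    ≡⟨ collect t (suc j) ⟩
    4 * t + suc j                                ∎
    where
    open ≡.≡-Reasoning
    t : ℕ
    t = tri (suc j)
    collect : ∀ t k → t + t + (k + (t + t)) ≡ 4 * t + k
    collect = solve-∀

  T-half≤T : ∀ m → T (m / 2) ≤ T m
  T-half≤T m = ≡.subst₂ _≤_ (≡.sym (T≡tri (m / 2))) (≡.sym (T≡tri m)) (tri-mono (s≤s (m/n≤m m 2)))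

  data Parity : ℕ → Set where
    zero : Parity 0
    odd  : ∀ j → Parity (suc (j * 2))
    even : ∀ j → Parity (suc j * 2)

  parity : ∀ m → Parity m
  parity zero = zero
  parity (suc m) with parity m
  ... | zero   = odd 0
  ... | odd j  = even j
  ... | even j = odd (suc j)

  T-odd : ∀ j → T (suc (j * 2)) ≡ 4 * tri (suc j) + suc j
  T-odd j = ≡.trans (T≡tri (suc (j * 2))) (≡.trans (cong tri (double j)) (tri-double (suc j)))
    where
    double : ∀ j → suc (suc (j * 2)) ≡ suc j + suc j
    double = solve-∀

  T-even : ∀ j → T (suc j * 2) ≡ 4 * tri (suc j) + suc j + (suc j + suc j)
  T-even j = ≡.trans (T≡tri (suc j * 2))
                     (cong₂ _+_ (≡.trans (cong tri (double j)) (tri-double (suc j))) (double j))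
    where
    double : ∀ j → suc j * 2 ≡ suc j + suc j
    double = solve-∀

  G-odd : ∀ j → G (suc (j * 2)) ≡ 3 * tri (suc j) + 1 * suc j
  G-odd j = begin
    T (suc (j * 2)) ∸ T (suc (j * 2) / 2)           ≡⟨ cong₂ _∸_ (T-odd j) (cong T (+-distrib-/-∣ʳ 1 {d = 2} (divides-refl j))) ⟩
    4 * t + suc j ∸ T (j * 2 / 2)                   ≡⟨ cong (λ x → 4 * t + suc j ∸ T x) (m*n/n≡m j 2) ⟩
    4 * t + suc j ∸ T j                             ≡⟨ cong₂ _∸_ (split t (suc j)) (T≡tri j) ⟩
    t + (3 * t + 1 * suc j) ∸ t                     ≡⟨ ℕ.m+n∸m≡n t _ ⟩
    3 * t + 1 * suc j                               ∎
    where
    open ≡.≡-Reasoning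
    t : ℕ
    t = tri (suc j)
    split : ∀ t k → 4 * t + k ≡ t + (3 * t + 1 * k)
    split = solve-∀

  G-even : ∀ j → G (suc j * 2) ≡ 3 * tri (suc j) + 2 * suc j
  G-even j = begin
    T (suc j * 2) ∸ T (suc j * 2 / 2)               ≡⟨ cong₂ _∸_ (T-even j) (cong T (m*n/n≡m (suc j) 2)) ⟩
    4 * t + suc j + (suc j + suc j) ∸ T (suc j)     ≡⟨ cong₂ _∸_ (split t (suc j)) (T≡tri (suc j)) ⟩
    t + suc j + (3 * t + 2 * suc j) ∸ (t + suc j)   ≡⟨ ℕ.m+n∸m≡n (t + suc j) _ ⟩
    3 * t + 2 * suc j                               ∎
    where
    open ≡.≡-Reasoning
    t : ℕ
    t = tri (suc j)
    split : ∀ t k → 4 * t + k + (k + k) ≡ t + k + (3 * t + 2 * k)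
    split = solve-∀

  G-<-suc : ∀ m → G m < G (suc m)
  G-<-suc m with parity m
  ... | zero   = s≤s z≤n
  ... | odd j  = ≡.subst₂ _<_ (≡.sym (G-odd j)) (≡.sym (G-even j))
                   (ℕ.+-monoʳ-< (3 * tri (suc j)) (ℕ.*-monoˡ-< (suc j) {1} {2} (s≤s (s≤s z≤n))))
  ... | even j = ≡.subst₂ _<_ (≡.sym (G-even j)) (≡.sym (G-odd (suc j)))
                   (≡.subst (3 * tri (suc j) + 2 * suc j <_) (gap (tri (suc j)) j) (s≤s (ℕ.m≤m+n _ (j + j + 2))))
    where
    gap : ∀ t j → suc (3 * t + 2 * suc j + (j + j + 2)) ≡ 3 * (t + suc j) + 1 * suc (suc j)
    gap = solve-∀

  G-strictMono : ∀ {m m′} → m < m′ → G m < G m′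
  G-strictMono {m} {suc m′} (s≤s m≤m′) with ℕ.m≤n⇒m<n∨m≡n m≤m′
  ... | inj₁ m<m′ = ℕ.<-trans (G-strictMono m<m′) (G-<-suc m′)
  ... | inj₂ refl = G-<-suc m

  G-injective : ∀ {m m′} → G m ≡ G m′ → m ≡ m′
  G-injective {m} {m′} Gm≡Gm′ with ℕ.<-cmp m m′
  ... | tri< m<m′ _ _ = ⊥-elim (ℕ.<-irrefl Gm≡Gm′ (G-strictMono m<m′))
  ... | tri≈ _ m≡m′ _ = m≡m′
  ... | tri> _ _ m>m′ = ⊥-elim (ℕ.<-irrefl (≡.sym Gm≡Gm′) (G-strictMono m>m′))

  m≤G : ∀ m → m ≤ G m
  m≤G zero    = z≤n
  m≤G (suc m) = ℕ.≤-<-trans (m≤G m) (G-<-suc m)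

  findIndexUpTo-just : ∀ n b m → findIndexUpTo n b ≡ just m → G m ≡ n
  findIndexUpTo-just n zero m eq with G zero ≟ n
  findIndexUpTo-just n zero .zero refl | yes Gm≡n = Gm≡n
  findIndexUpTo-just n zero m ()       | no _
  findIndexUpTo-just n (suc b) m eq with findIndexUpTo n b in found
  findIndexUpTo-just n (suc b) m refl | just _ = findIndexUpTo-just n b m found
  ... | nothing with G (suc b) ≟ n
  findIndexUpTo-just n (suc b) .(suc b) refl | nothing | yes Gm≡n = Gm≡n
  findIndexUpTo-just n (suc b) m ()          | nothing | no _

  findIndexUpTo-nothing : ∀ n b → findIndexUpTo n b ≡ nothing → ∀ m → m ≤ b → G m ≢ n
  findIndexUpTo-nothing n zero eq m m≤b with G zero ≟ n
  findIndexUpTo-nothing n zero ()   m    m≤b | yes _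
  findIndexUpTo-nothing n zero eq   zero z≤n | no G0≢n = G0≢n
  findIndexUpTo-nothing n (suc b) eq m m≤b with findIndexUpTo n b in found
  findIndexUpTo-nothing n (suc b) () m m≤b | just _
  ... | nothing with G (suc b) ≟ n
  findIndexUpTo-nothing n (suc b) () m m≤b | nothing | yes _
  findIndexUpTo-nothing n (suc b) eq m m≤b | nothing | no Gb≢n with ℕ.m≤n⇒m<n∨m≡n m≤b
  ... | inj₁ (s≤s m≤b′) = findIndexUpTo-nothing n b found m m≤b′
  ... | inj₂ refl       = Gb≢n

  pentIndex-just : ∀ n {m} → pentIndex n ≡ just m → G m ≡ n
  pentIndex-just n = findIndexUpTo-just n n _

  pentIndex-nothing : ∀ n → pentIndex n ≡ nothing → ∀ m → G m ≢ n
  pentIndex-nothing n eq m with m ≤? n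
  ... | yes m≤n = findIndexUpTo-nothing n n eq m m≤n
  ... | no m≰n  = λ Gm≡n → m≰n (≡.subst (m ≤_) Gm≡n (m≤G m))

module PentagonalCoefficients where

  open import Data.Nat using (_≤_; _<_)
  open import Data.Integer using (_+_; _*_; _^_)
  open import Data.Nat.Tactic.RingSolver using (solve-∀)
  open Series
  open Monomials
  open Products
  open Triangular
  open Pentagonal
  open Identities using (pentagonalSeries)
  open import Data.Nat.DivMod using (_/_)

  pentagonalSum : (ℕ → ℤ) → ℕ → Series
  pentagonalSum w K = ∑ K (λ m → κ (w m) ⊛ q^ (G m))

  module _ (s : ℤ) (s²≡1 : s * s ≡ + 1) where

    open Sign s s²≡1

    pentagonalTerm : ℕ → Series
    pentagonalTerm m = κ (s ^ T m) ⊛ q^ (G m)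

    θ⁺-term≈pentagonalTerm : ∀ j → κ (s ^ suc j) ⊛ q^ (3 ℕ.* tri (suc j) ℕ.+ 1 ℕ.* suc j) ≈ pentagonalTerm (suc (j ℕ.* 2))
    θ⁺-term≈pentagonalTerm j = ⊛-cong
      (≈-reflexive (cong κ (^-parity (suc j) _ (2 ℕ.* t ℕ.+ suc j)
                                      (≡.trans (cong (suc j ℕ.+_) (T-odd j)) (halve t (suc j))))))
      (q^-cong (≡.sym (G-odd j)))
      where
      t : ℕ
      t = tri (suc j)
      halve : ∀ t k → k ℕ.+ (4 ℕ.* t ℕ.+ k) ≡ 2 ℕ.* t ℕ.+ k ℕ.+ (2 ℕ.* t ℕ.+ k)
      halve = solve-∀

    θ⁻-term≈pentagonalTerm : ∀ j → κ (s ^ suc j) ⊛ q^ (3 ℕ.* tri (suc j) ℕ.+ 2 ℕ.* suc j) ≈ pentagonalTerm (suc j ℕ.* 2)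
    θ⁻-term≈pentagonalTerm j = ⊛-cong
      (≈-reflexive (cong κ (^-parity (suc j) _ (2 ℕ.* t ℕ.+ 2 ℕ.* suc j)
                                      (≡.trans (cong (suc j ℕ.+_) (T-even j)) (halve t (suc j))))))
      (q^-cong (≡.sym (G-even j)))
      where
      t : ℕ
      t = tri (suc j)
      halve : ∀ t k → k ℕ.+ (4 ℕ.* t ℕ.+ k ℕ.+ (k ℕ.+ k)) ≡ 2 ℕ.* t ℕ.+ 2 ℕ.* k ℕ.+ (2 ℕ.* t ℕ.+ 2 ℕ.* k)
      halve = solve-∀

    pentagonalSeries≈pentagonalSum : ∀ M → pentagonalSeries s M ≈ pentagonalSum (λ m → s ^ T m) (suc (suc M ℕ.* 2))
    pentagonalSeries≈pentagonalSum M = begin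
        A 0 ⊕ ∑ K (A ∘ suc) ⊕ ∑ K D′
      ≈⟨ ⊕-assoc (A 0) _ _ ⟩
        A 0 ⊕ (∑ K (A ∘ suc) ⊕ ∑ K D′)
      ≈⟨ ⊕-congˡ {x = A 0} (≈-sym (∑-⊕ K (A ∘ suc) D′)) ⟩
        A 0 ⊕ ∑ K (λ j → A (suc j) ⊕ D′ j)
      ≈⟨ ⊕-congˡ {x = A 0} (∑-cong K (λ j _ → ⊕-cong
           (≈-trans (θ⁺-term≈pentagonalTerm j) (≈-reflexive (cong (F ∘ suc) (≡.sym (ℕ.+-identityʳ (j ℕ.* 2))))))
           (≈-trans (θ⁻-term≈pentagonalTerm j) (≈-trans (≈-reflexive (cong (F ∘ suc) (ℕ.+-comm 1 (j ℕ.* 2))))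
                                                       (≈-sym (⊕-identityʳ _)))))) ⟩
        F 0 ⊕ ∑ K (λ i → ∑ 2 (λ j → F (suc (i ℕ.* 2 ℕ.+ j))))
      ≈⟨ ⊕-congˡ {x = F 0} (≈-sym (∑-blocks K 2 (F ∘ suc))) ⟩
        ∑ (suc (K ℕ.* 2)) F
      ∎
      where
      open SetoidReasoning setoid
      K : ℕ
      K = suc M
      F : ℕ → Series
      F = pentagonalTerm
      A D′ : ℕ → Series
      A j = κ (s ^ j) ⊛ q^ (3 ℕ.* tri j ℕ.+ 1 ℕ.* j)
      D′ j = κ (s ^ suc j) ⊛ q^ (3 ℕ.* tri (suc j) ℕ.+ 2 ℕ.* suc j)

  pentagonalSum-at-index : ∀ w K {n m} → G m ≡ n → m < K → pentagonalSum w K n ≡ w m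
  pentagonalSum-at-index w K {n} {m} Gm≡n m<K = ≡.trans
    (∑-at-single K _ n m m<K λ i _ i≢m → ≡.trans (at (κ-⊛ (w i) (q^ (G i))) n)
      (≡.trans (cong (w i *_) (q^-at-other (G i) n (λ Gi≡n → i≢m (G-injective (≡.trans Gi≡n (≡.sym Gm≡n))))))
               (ℤ.*-zeroʳ (w i))))
    (≡.trans (at (κ-⊛ (w m) (q^ (G m))) n)
      (≡.trans (cong (λ k → w m * (q^ (G m)) k) (≡.sym Gm≡n))
               (≡.trans (cong (w m *_) (q^-at-self (G m))) (ℤ.*-identityʳ (w m)))))

  pentagonalSum-at-non-index : ∀ w K {n} → (∀ m → G m ≢ n) → pentagonalSum w K n ≡ + 0
  pentagonalSum-at-non-index w K {n} G≢n = ∑-at-zero K _ n λ i _ →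
    ≡.trans (at (κ-⊛ (w i) (q^ (G i))) n) (≡.trans (cong (w i *_) (q^-at-other (G i) n (G≢n i))) (ℤ.*-zeroʳ (w i)))

  private
    bound : ∀ {n m M} → G m ≡ n → n < M → m < suc (suc M ℕ.* 2)
    bound {n} {m} {M} Gm≡n n<M = ℕ.<-trans (ℕ.≤-<-trans (≡.subst (m ≤_) Gm≡n (m≤G m)) n<M)
                                           (s≤s (ℕ.≤-trans (ℕ.n≤1+n M) (ℕ.m≤m*n (suc M) 2)))

  pentagonalSeries-at-ε₁ : ∀ M n → n < M → pentagonalSeries -1ℤ M n ≡ ε₁ n
  pentagonalSeries-at-ε₁ M n n<M with pentIndex n in index
  ... | just m  = ≡.trans (at (pentagonalSeries≈pentagonalSum -1ℤ refl M) n)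
                          (pentagonalSum-at-index (λ m → -1ℤ ^ T m) _ {m = m} Gm≡n (bound {m = m} Gm≡n n<M))
    where
    Gm≡n : G m ≡ n
    Gm≡n = pentIndex-just n {m} index
  ... | nothing = ≡.trans (at (pentagonalSeries≈pentagonalSum -1ℤ refl M) n)
                          (pentagonalSum-at-non-index (λ m → -1ℤ ^ T m) (suc (suc M ℕ.* 2)) (pentIndex-nothing n index))

  pentagonalSeries-at-ε₃ : ∀ M n → n < M → pentagonalSeries (+ 1) M n ≡ ε₃ n
  pentagonalSeries-at-ε₃ M n n<M with pentIndex n in index
  ... | just m  = ≡.trans (at (pentagonalSeries≈pentagonalSum (+ 1) refl M) n)
                          (≡.trans (pentagonalSum-at-index (λ m → (+ 1) ^ T m) _ {m = m} Gm≡n (bound {m = m} Gm≡n n<M))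
                                   (ℤ.^-zeroˡ (T m)))
    where
    Gm≡n : G m ≡ n
    Gm≡n = pentIndex-just n {m} index
  ... | nothing = ≡.trans (at (pentagonalSeries≈pentagonalSum (+ 1) refl M) n)
                          (pentagonalSum-at-non-index (λ m → (+ 1) ^ T m) (suc (suc M ℕ.* 2)) (pentIndex-nothing n index))

  -- (-1)^G(m) (-1)^T(m) = (-1)^T(⌊m/2⌋), because G m = T m - T ⌊m/2⌋.
  σ-pentagonalSeries-at-ε₂ : ∀ M n → n < M → Twist.σ (pentagonalSeries -1ℤ M) n ≡ ε₂ n
  σ-pentagonalSeries-at-ε₂ M n n<M with pentIndex n in index
  ... | just m  = begin
      -1ℤ ^ n * pentagonalSeries -1ℤ M n
    ≡⟨ cong (-1ℤ ^ n *_) (≡.trans (at (pentagonalSeries≈pentagonalSum -1ℤ refl M) n)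
                                   (pentagonalSum-at-index (λ m → -1ℤ ^ T m) _ {m = m} Gm≡n (bound {m = m} Gm≡n n<M))) ⟩
      -1ℤ ^ n * -1ℤ ^ T m
    ≡⟨ cong (λ k → -1ℤ ^ k * -1ℤ ^ T m) (≡.sym Gm≡n) ⟩
      -1ℤ ^ G m * -1ℤ ^ T m
    ≡⟨ cong (λ k → -1ℤ ^ G m * -1ℤ ^ k) (≡.sym (ℕ.m∸n+n≡m (T-half≤T m))) ⟩
      -1ℤ ^ G m * -1ℤ ^ (G m ℕ.+ T (m / 2))
    ≡⟨ cong (-1ℤ ^ G m *_) (ℤ.^-distribˡ-+-* -1ℤ (G m) (T (m / 2))) ⟩
      -1ℤ ^ G m * (-1ℤ ^ G m * -1ℤ ^ T (m / 2))
    ≡⟨ ℤ.*-assoc (-1ℤ ^ G m) _ _ ⟨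
      -1ℤ ^ G m * -1ℤ ^ G m * -1ℤ ^ T (m / 2)
    ≡⟨ cong (_* -1ℤ ^ T (m / 2)) (^-square (G m)) ⟩
      + 1 * -1ℤ ^ T (m / 2)
    ≡⟨ ℤ.*-identityˡ _ ⟩
      -1ℤ ^ T (m / 2)
    ∎
    where
    open ≡.≡-Reasoning
    open Sign -1ℤ refl
    Gm≡n : G m ≡ n
    Gm≡n = pentIndex-just n {m} index
  ... | nothing = ≡.trans (cong (-1ℤ ^ n *_) (≡.trans (at (pentagonalSeries≈pentagonalSum -1ℤ refl M) n)
                   (pentagonalSum-at-non-index (λ m → -1ℤ ^ T m) (suc (suc M ℕ.* 2)) (pentIndex-nothing n index))))
                          (ℤ.*-zeroʳ (-1ℤ ^ n))

module DistinctPartitions where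

  open import Data.Nat using (_≤_; _<_; _+_; _≤?_)
  open import Relation.Nullary using (¬_)
  open Series
  open Monomials
  open Truncation
  open Products
  open Pochhammer
  open Identities using (distinctParts)

  D-suc-≤ : ∀ n m → suc m ≤ n → D n (suc m) ≡ D n m + D (n ∸ suc m) m
  D-suc-≤ (suc n) m 1+m≤n with suc m ≤? suc n
  ... | yes _     = refl
  ... | no 1+m≰n = ⊥-elim (1+m≰n 1+m≤n)

  D-suc-≰ : ∀ n m → ¬ (suc m ≤ n) → D n (suc m) ≡ D n m
  D-suc-≰ zero    m _ = refl
  D-suc-≰ (suc n) m 1+m≰n with suc m ≤? suc n
  ... | yes 1+m≤n = ⊥-elim (1+m≰n 1+m≤n)
  ... | no _      = refl

  poch₁-suc : ∀ m → poch (+ 1) 1 1 (suc m) ≈ poch (+ 1) 1 1 m ⊕ shift (suc m) (poch (+ 1) 1 1 m)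
  poch₁-suc m = ≈-trans (∏-suc-last m _) (≈-trans
    (⊛-congˡ (factor-cong (+ 1) (≡.trans (ℕ.+-comm (1 ℕ.* m) 1) (cong suc (ℕ.*-identityˡ m)))))
    (≈-trans (solve 2 (λ p x → p :* (con (+ 1) :+ con (+ 1) :* x) := p :+ x :* p) ≈-refl (poch (+ 1) 1 1 m) (q^ (suc m)))
             (⊕-congˡ {x = poch (+ 1) 1 1 m} (q^-⊛ (suc m) _))))

  D-coefficient : ∀ n m → + D n m ≡ poch (+ 1) 1 1 m n
  D-coefficient zero    zero    = refl
  D-coefficient (suc n) zero    = refl
  D-coefficient n       (suc m) with suc m ≤? n
  ... | yes 1+m≤n = begin
      + D n (suc m)
    ≡⟨ cong +_ (D-suc-≤ n m 1+m≤n) ⟩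
      + D n m ℤ.+ + D (n ∸ suc m) m
    ≡⟨ cong₂ ℤ._+_ (D-coefficient n m) (D-coefficient (n ∸ suc m) m) ⟩
      P n ℤ.+ P (n ∸ suc m)
    ≡⟨ cong (ℤ._+_ (P n)) (shift-high (suc m) P (n ∸ suc m)) ⟨
      P n ℤ.+ shift (suc m) P (suc m + (n ∸ suc m))
    ≡⟨ cong (λ k → P n ℤ.+ shift (suc m) P k) (ℕ.m+[n∸m]≡n 1+m≤n) ⟩
      P n ℤ.+ shift (suc m) P n
    ≡⟨ at (poch₁-suc m) n ⟨
      poch (+ 1) 1 1 (suc m) n
    ∎
    where
    open ≡.≡-Reasoning
    P : Series
    P = poch (+ 1) 1 1 m
  ... | no 1+m≰n = begin
      + D n (suc m)                                      ≡⟨ cong +_ (D-suc-≰ n m 1+m≰n) ⟩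
      + D n m                                            ≡⟨ D-coefficient n m ⟩
      P n                                                ≡⟨ ℤ.+-identityʳ (P n) ⟨
      P n ℤ.+ + 0                                         ≡⟨ cong (ℤ._+_ (P n)) (shift-low (suc m) P (ℕ.≰⇒> 1+m≰n)) ⟨
      P n ℤ.+ shift (suc m) P n                           ≡⟨ at (poch₁-suc m) n ⟨
      poch (+ 1) 1 1 (suc m) n                           ∎
    where
    open ≡.≡-Reasoning
    P : Series
    P = poch (+ 1) 1 1 m

  Q-coefficient : ∀ n M → n < M → + Q n ≡ distinctParts M n
  Q-coefficient n M n<M = ≡.trans (D-coefficient n n) (≡.sym (below
    (≡.subst (λ K → poch (+ 1) 1 1 K ≈[ suc n ] poch (+ 1) 1 1 n) (ℕ.m+[n∸m]≡n (ℕ.<⇒≤ n<M))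
             (poch-≈[]-drop (+ 1) 1 1 n (M ∸ n)
               (ℕ.≤-reflexive (≡.trans (ℕ.+-comm 1 n) (cong (_+ 1) (≡.sym (ℕ.*-identityˡ n)))))))
    n ℕ.≤-refl))

  D-monoʳ : ∀ x m → D x m ≤ D x (suc m)
  D-monoʳ x m with suc m ≤? x
  ... | yes 1+m≤x = ≡.subst (D x m ≤_) (≡.sym (D-suc-≤ x m 1+m≤x)) (ℕ.m≤m+n _ _)
  ... | no 1+m≰x  = ℕ.≤-reflexive (≡.sym (D-suc-≰ x m 1+m≰x))

  D-zero : ∀ m → D 0 m ≡ 1
  D-zero zero    = refl
  D-zero (suc m) = ≡.trans (D-suc-≰ 0 m (λ ())) (D-zero m)

  D-one : ∀ m → D 1 (suc m) ≡ 1
  D-one zero    = refl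
  D-one (suc m) = ≡.trans (D-suc-≰ 1 (suc m) (λ { (s≤s ()) })) (D-one m)

  -- Increasing the largest part by one.
  D-suc-suc : ∀ x m → D x m ≤ D (suc x) (suc m)
  D-suc-suc zero    zero = s≤s z≤n
  D-suc-suc (suc x) zero = z≤n
  D-suc-suc x (suc m) with suc m ≤? x
  ... | yes 1+m≤x = ≡.subst₂ _≤_ (≡.sym (D-suc-≤ x m 1+m≤x)) (≡.sym (D-suc-≤ (suc x) (suc m) (s≤s 1+m≤x)))
                      (ℕ.+-mono-≤ (D-suc-suc x m) (D-monoʳ (x ∸ suc m) m))
  ... | no 1+m≰x  = ≡.subst (_≤ D (suc x) (suc (suc m))) (≡.sym (D-suc-≰ x m 1+m≰x))
                      (ℕ.≤-trans (D-suc-suc x m) (D-monoʳ (suc x) (suc m)))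

  -- Increasing the two largest parts by one each.
  D-2+-2+ : ∀ x m → D x (suc m) ≤ D (2 + x) (2 + m)
  D-2+-2+ zero          zero = s≤s z≤n
  D-2+-2+ (suc zero)    zero = s≤s z≤n
  D-2+-2+ (suc (suc x)) zero =
    ≡.subst (_≤ D (4 + x) 2) (≡.sym (D-suc-≤ (2 + x) zero (s≤s z≤n))) z≤n
  D-2+-2+ x (suc m) with 2 + m ≤? x
  ... | yes 2+m≤x = ≡.subst₂ _≤_ (≡.sym (D-suc-≤ x (suc m) 2+m≤x))
                      (≡.sym (D-suc-≤ (2 + x) (2 + m) (s≤s (s≤s (ℕ.<⇒≤ 2+m≤x)))))
                      (ℕ.+-mono-≤ (D-2+-2+ x m)
                        (≡.subst (λ y → D (x ∸ (2 + m)) (suc m) ≤ D y (2 + m)) (≡.sym (ℕ.+-∸-assoc 1 2+m≤x))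
                                 (D-suc-suc (x ∸ (2 + m)) (suc m))))
  ... | no 2+m≰x  = ≡.subst (_≤ D (2 + x) (3 + m)) (≡.sym (D-suc-≰ x (suc m) 2+m≰x))
                      (ℕ.≤-trans (D-2+-2+ x m) (D-monoʳ (2 + x) (2 + m)))

  Q-mono : ∀ {x y} → x ≤ y → Q x ≤ Q y
  Q-mono {x} {y} x≤y = ≡.subst (λ z → Q x ≤ Q z) (ℕ.m+[n∸m]≡n x≤y) (go (y ∸ x))
    where
    go : ∀ d → Q x ≤ Q (x + d)
    go zero    = ℕ.≤-reflexive (cong Q (≡.sym (ℕ.+-identityʳ x)))
    go (suc d) = ℕ.≤-trans (go d) (≡.subst (λ z → Q (x + d) ≤ Q z) (≡.sym (ℕ.+-suc x d)) (D-suc-suc (x + d) (x + d)))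

  Q-suc : ∀ x → Q (suc x) ≡ D (suc x) x + 1
  Q-suc x = ≡.trans (D-suc-≤ (suc x) x ℕ.≤-refl)
                    (cong (_+_ (D (suc x) x)) (≡.trans (cong (λ z → D z x) (ℕ.n∸n≡0 x)) (D-zero x)))

  Q-positive : ∀ x → 0 < Q x
  Q-positive zero    = s≤s z≤n
  Q-positive (suc x) = ≡.subst (0 <_) (≡.sym (Q-suc x)) (ℕ.m≤n+m 1 (D (suc x) x))

  Q-<-3+ : ∀ x → Q (suc x) < Q (3 + x)
  Q-<-3+ zero     = s≤s (s≤s z≤n)
  Q-<-3+ (suc x) = ≡.subst₂ _<_ (≡.sym (Q-suc (suc x))) (≡.sym Q[4+x])
    (≡.subst (_≤ D (4 + x) (2 + x) + 2) (ℕ.+-suc (D (2 + x) (suc x)) 1) (ℕ.+-monoˡ-≤ 2 (D-2+-2+ (2 + x) x)))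
    where
    Q[4+x] : Q (4 + x) ≡ D (4 + x) (2 + x) + 2
    Q[4+x] = begin
      Q (4 + x)                                     ≡⟨ Q-suc (3 + x) ⟩
      D (4 + x) (3 + x) + 1                          ≡⟨ cong (_+ 1) (D-suc-≤ (4 + x) (2 + x) (ℕ.n≤1+n _)) ⟩
      D (4 + x) (2 + x) + D (4 + x ∸ (3 + x)) (2 + x) + 1
                                                     ≡⟨ cong (λ y → D (4 + x) (2 + x) + D y (2 + x) + 1) (ℕ.m+n∸n≡m 1 (3 + x)) ⟩
      D (4 + x) (2 + x) + D 1 (2 + x) + 1            ≡⟨ cong (λ y → D (4 + x) (2 + x) + y + 1) (D-one (suc x)) ⟩
      D (4 + x) (2 + x) + 1 + 1                      ≡⟨ ℕ.+-assoc _ 1 1 ⟩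
      D (4 + x) (2 + x) + 2                          ∎
      where open ≡.≡-Reasoning

  Q-strict : ∀ x d → 3 ≤ d → Q x < Q (x + d)
  Q-strict zero    d 3≤d = ℕ.<-≤-trans (Q-<-3+ zero) (Q-mono 3≤d)
  Q-strict (suc x) d 3≤d = ℕ.<-≤-trans (Q-<-3+ x)
    (Q-mono (ℕ.m≤n⇒m≤1+n (≡.subst (_≤ x + d) (ℕ.+-comm x 3) (ℕ.+-monoʳ-≤ x 3≤d))))

module Coefficients where

  open import Data.Nat using (_≤_; _<_)
  open import Data.Integer using (_+_; _-_; _*_; _^_)
  open import Data.Integer.Tactic.RingSolver using (solve-∀)
  open Series
  open Monomials
  open Truncation
  open Products
  open Triangular
  open Identities
  open PentagonalCoefficients
  open DistinctPartitions
  open BigOperator ℤ.+-0-commutativeMonoid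
    using () renaming (big to ∑ℤ; big-cong to ∑ℤ-cong; big-suc-last to ∑ℤ-suc-last)

  Q-minus-≤ : ∀ {n e} → e ≤ n → Qℤ (+ n - + e) ≡ Q (n ∸ e)
  Q-minus-≤ {n} {e} e≤n = cong Qℤ (≡.trans (ℤ.m-n≡m⊖n n e) (ℤ.⊖-≥ e≤n))

  Q-minus-> : ∀ {n e} → n < e → Qℤ (+ n - + e) ≡ 0
  Q-minus-> {n} {e} n<e with e ∸ n | ≡.trans (ℤ.m-n≡m⊖n n e) (ℤ.⊖-< n<e) | ℕ.m<n⇒0<n∸m n<e
  ... | suc k | n-e≡-[1+k] | _ = cong Qℤ n-e≡-[1+k]

  shift-distinctParts-at : ∀ M e n → n < M → shift e (distinctParts M) n ≡ + Qℤ (+ n - + e)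
  shift-distinctParts-at M e n n<M with e ℕ.≤? n
  ... | yes e≤n = begin
      shift e (distinctParts M) n                   ≡⟨ cong (shift e (distinctParts M)) (ℕ.m+[n∸m]≡n e≤n) ⟨
      shift e (distinctParts M) (e ℕ.+ (n ∸ e))     ≡⟨ shift-high e (distinctParts M) (n ∸ e) ⟩
      distinctParts M (n ∸ e)                       ≡⟨ Q-coefficient (n ∸ e) M (ℕ.≤-<-trans (ℕ.m∸n≤m n e) n<M) ⟨
      + Q (n ∸ e)                                   ≡⟨ cong +_ (Q-minus-≤ e≤n) ⟨
      + Qℤ (+ n - + e)                              ∎
    where open ≡.≡-Reasoning
  ... | no e≰n = ≡.trans (shift-low e (distinctParts M) (ℕ.≰⇒> e≰n)) (cong +_ (≡.sym (Q-minus-> (ℕ.≰⇒> e≰n))))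

  ∑-at : ∀ K F n → ∑ K F n ≡ ∑ℤ K (λ i → F i n)
  ∑-at zero    F n = refl
  ∑-at (suc K) F n = cong (_+_ (F 0 n)) (∑-at K (F ∘ suc) n)

  Σ₁≡∑ℤ : ∀ K g → Σ₁ K g ≡ ∑ℤ K (g ∘ suc)
  Σ₁≡∑ℤ zero    g = refl
  Σ₁≡∑ℤ (suc K) g = ≡.trans (cong (_+ g (suc K)) (Σ₁≡∑ℤ K g)) (≡.sym (∑ℤ-suc-last K (g ∘ suc)))

  squareTerm : ℕ → ℕ → Series
  squareTerm c j = κ (-1ℤ ^ suc j) ⊛ q^ (c ℕ.* (suc j ℕ.* suc j))

  thetaSquares≈ : ∀ c M → thetaSquares c M ≈ 1ₛ ⊕ (∑ (suc M) (squareTerm c) ⊕ ∑ (suc M) (squareTerm c))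
  thetaSquares≈ c M = ≈-trans (⊕-congʳ (⊕-cong constant (∑-cong (suc M) (λ j _ → term j))))
    (≈-trans (⊕-assoc 1ₛ _ _) (⊕-congˡ {x = 1ₛ} (⊕-congˡ {x = ∑ (suc M) (squareTerm c)} (∑-cong (suc M) (λ j _ → term j)))))
    where
    constant : κ (-1ℤ ^ 0) ⊛ q^ ((c ℕ.+ c) ℕ.* 0 ℕ.+ c ℕ.* 0) ≈ 1ₛ
    constant = ≈-trans (⊛-congˡ (q^-cong (cong₂ ℕ._+_ (ℕ.*-zeroʳ (c ℕ.+ c)) (ℕ.*-zeroʳ c)))) (⊛-identityˡ 1ₛ)
    exponent : ∀ j → (c ℕ.+ c) ℕ.* tri (suc j) ℕ.+ c ℕ.* suc j ≡ c ℕ.* (suc j ℕ.* suc j)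
    exponent j = begin
      (c ℕ.+ c) ℕ.* tri (suc j) ℕ.+ c ℕ.* suc j      ≡⟨ collect c (tri (suc j)) (suc j) ⟩
      c ℕ.* (tri (suc j) ℕ.+ tri (suc j) ℕ.+ suc j)  ≡⟨ cong (λ t → c ℕ.* (t ℕ.+ suc j)) (tri-suc-double j) ⟩
      c ℕ.* (suc j ℕ.* j ℕ.+ suc j)                  ≡⟨ cong (c ℕ.*_) (square j) ⟩
      c ℕ.* (suc j ℕ.* suc j)                        ∎
      where
      open ≡.≡-Reasoning
      open import Data.Nat.Tactic.RingSolver renaming (solve-∀ to solve-ℕ)
      collect : ∀ c t k → (c ℕ.+ c) ℕ.* t ℕ.+ c ℕ.* k ≡ c ℕ.* (t ℕ.+ t ℕ.+ k)
      collect = solve-ℕ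
      square : ∀ j → suc j ℕ.* j ℕ.+ suc j ≡ suc j ℕ.* suc j
      square = solve-ℕ
    term : ∀ j → κ (-1ℤ ^ suc j) ⊛ q^ ((c ℕ.+ c) ℕ.* tri (suc j) ℕ.+ c ℕ.* suc j) ≈ squareTerm c j
    term j = ⊛-congˡ (q^-cong (exponent j))

  distinctParts⊛thetaSquares-at : ∀ c M n → n < M →
    (distinctParts M ⊛ thetaSquares c M) n ≡ + Q n + + 2 * Σ₁ (suc M) (λ j → -1ℤ ^ j * + Qℤ (+ n - + (c ℕ.* (j ℕ.* j))))
  distinctParts⊛thetaSquares-at c M n n<M = begin
      (P ⊛ thetaSquares c M) n
    ≡⟨ at (≈-trans (⊛-congˡ (thetaSquares≈ c M))
                   (solve 2 (λ p s → p :* (con (+ 1) :+ (s :+ s)) := p :+ (p :* s :+ p :* s)) ≈-refl P S)) n ⟩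
      P n + ((P ⊛ S) n + (P ⊛ S) n)
    ≡⟨ cong₂ (λ x y → x + (y + y)) (≡.sym (Q-coefficient n M n<M)) PS-at ⟩
      + Q n + (Σ₁ (suc M) g + Σ₁ (suc M) g)
    ≡⟨ double (+ Q n) (Σ₁ (suc M) g) ⟩
      + Q n + + 2 * Σ₁ (suc M) g
    ∎
    where
    open ≡.≡-Reasoning
    P S : Series
    P = distinctParts M
    S = ∑ (suc M) (squareTerm c)
    g : ℕ → ℤ
    g j = -1ℤ ^ j * + Qℤ (+ n - + (c ℕ.* (j ℕ.* j)))
    double : ∀ a b → a + (b + b) ≡ a + + 2 * b
    double = solve-∀
    term-at : ∀ j → (P ⊛ squareTerm c j) n ≡ g (suc j)
    term-at j = ≡.trans (at (≈-trans (solve 3 (λ p k x → p :* (k :* x) := k :* (x :* p)) ≈-refl P (κ (-1ℤ ^ suc j)) (q^ e))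
                                     (≈-trans (κ-⊛ _ _) (mk≈ (λ k → cong (-1ℤ ^ suc j *_) (at (q^-⊛ e P) k))))) n)
                        (cong (-1ℤ ^ suc j *_) (shift-distinctParts-at M e n n<M))
      where
      e : ℕ
      e = c ℕ.* (suc j ℕ.* suc j)
    PS-at : (P ⊛ S) n ≡ Σ₁ (suc M) g
    PS-at = ≡.trans (at (⊛-∑ (suc M) P (squareTerm c)) n)
              (≡.trans (∑-at (suc M) (λ j → P ⊛ squareTerm c j) n)
                       (≡.trans (∑ℤ-cong (suc M) (λ j _ → term-at j)) (≡.sym (Σ₁≡∑ℤ (suc M) g))))

  signedQ : ℕ → ℕ → ℕ → ℤ
  signedQ c n j = -1ℤ ^ j * + Qℤ (+ n - + (c ℕ.* (j ℕ.* j)))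

  Q-identity₁ : ∀ n M → n < M → + Q n + + 2 * Σ₁ (suc M) (signedQ 1 n) ≡ ε₁ n
  Q-identity₁ n M n<M = ≡.trans (≡.sym (distinctParts⊛thetaSquares-at 1 M n n<M))
    (≡.trans (below (distinctParts⊛thetaSquares₁ M) n n<M) (pentagonalSeries-at-ε₁ M n n<M))

  Q-identity₂ : ∀ n M → n < M → + Q n + + 2 * Σ₁ (suc M) (signedQ 2 n) ≡ ε₂ n
  Q-identity₂ n M n<M = ≡.trans (≡.sym (distinctParts⊛thetaSquares-at 2 M n n<M))
    (≡.trans (below (distinctParts⊛thetaSquares₂ M) n n<M) (σ-pentagonalSeries-at-ε₂ M n n<M))

  Q-identity₃ : ∀ n M → n < M → + Q n + + 2 * Σ₁ (suc M) (signedQ 3 n) ≡ ε₃ n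
  Q-identity₃ n M n<M = ≡.trans (≡.sym (distinctParts⊛thetaSquares-at 3 M n n<M))
    (≡.trans (below (distinctParts⊛thetaSquares₃ M) n n<M) (pentagonalSeries-at-ε₃ M n n<M))

module AlternatingSums where

  open import Data.Nat using (_≤_)
  open import Data.Integer using (_+_; _-_; _*_; -_; _^_)
  open BigOperator ℤ.+-0-commutativeMonoid public
    using () renaming (big to ∑ℤ; big-cong to ∑ℤ-cong)

  alt : ℕ → (ℕ → ℕ) → ℤ
  alt L B = ∑ℤ L (λ t → -1ℤ ^ t * + B t)

  Antitone : (ℕ → ℕ) → Set
  Antitone B = ∀ t → B (suc t) ℕ.≤ B t

  ∑ℤ-*ˡ : ∀ L a f → ∑ℤ L (λ t → a * f t) ≡ a * ∑ℤ L f
  ∑ℤ-*ˡ zero    a f = ≡.sym (ℤ.*-zeroʳ a)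
  ∑ℤ-*ˡ (suc L) a f = ≡.trans (cong (_+_ (a * f 0)) (∑ℤ-*ˡ L a (f ∘ suc))) (≡.sym (ℤ.*-distribˡ-+ a (f 0) _))

  alt-suc : ∀ L B → alt (suc L) B ≡ + B 0 - alt L (B ∘ suc)
  alt-suc L B = cong₂ _+_ (ℤ.*-identityˡ (+ B 0)) (begin
    ∑ℤ L (λ t → -1ℤ * -1ℤ ^ t * + B (suc t))     ≡⟨ ∑ℤ-cong L (λ t _ → ℤ.*-assoc -1ℤ (-1ℤ ^ t) (+ B (suc t))) ⟩
    ∑ℤ L (λ t → -1ℤ * (-1ℤ ^ t * + B (suc t)))   ≡⟨ ∑ℤ-*ˡ L -1ℤ _ ⟩
    -1ℤ * alt L (B ∘ suc)                        ≡⟨ ℤ.-1*i≡-i _ ⟩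
    - alt L (B ∘ suc)                            ∎)
    where open ≡.≡-Reasoning

  alt-bounds : ∀ L B → Antitone B → + 0 ℤ.≤ alt L B × alt L B ℤ.≤ + B 0
  alt-bounds zero    B _    = ℤ.≤-refl , ℤ.+≤+ z≤n
  alt-bounds (suc L) B anti with alt-bounds L (B ∘ suc) (anti ∘ suc)
  ... | 0≤alt , alt≤B₁ = ≡.subst (+ 0 ℤ.≤_) (≡.sym (alt-suc L B))
                           (≡.subst (ℤ._≤ + B 0 - alt L (B ∘ suc)) (ℤ.+-inverseʳ (+ B 0))
                                    (ℤ.+-monoʳ-≤ (+ B 0) (ℤ.neg-mono-≤ (ℤ.≤-trans alt≤B₁ (ℤ.+≤+ (anti 0))))))
                       , ≡.subst (ℤ._≤ + B 0) (≡.sym (alt-suc L B))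
                           (≡.subst (+ B 0 - alt L (B ∘ suc) ℤ.≤_) (ℤ.+-identityʳ (+ B 0))
                                    (ℤ.+-monoʳ-≤ (+ B 0) (ℤ.neg-mono-≤ 0≤alt)))

  alt-≥-difference : ∀ L B → Antitone B → + B 0 - + B 1 ℤ.≤ alt (suc L) B
  alt-≥-difference L B anti = ≡.subst (+ B 0 - + B 1 ℤ.≤_) (≡.sym (alt-suc L B))
    (ℤ.+-monoʳ-≤ (+ B 0) (ℤ.neg-mono-≤ (proj₂ (alt-bounds L (B ∘ suc) (anti ∘ suc)))))

  alt-zero : ∀ L B → (∀ t → B t ≡ 0) → alt L B ≡ + 0
  alt-zero zero    B B≡0 = refl
  alt-zero (suc L) B B≡0 = ≡.trans (alt-suc L B)
    (cong₂ (λ b a → + b - a) (B≡0 0) (alt-zero L (B ∘ suc) (B≡0 ∘ suc)))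

module Inequality (c′ : ℕ) (ε : ℕ → ℤ)
  (identity : ∀ n M → n ℕ.< M → + Q n ℤ.+ + 2 ℤ.* Σ₁ (suc M) (Coefficients.signedQ (suc c′) n) ≡ ε n) where

  open import Data.Nat using (_≤_; _<_)
  open import Data.Integer using (_+_; _-_; _*_; -_; _^_)
  open import Data.Integer.Tactic.RingSolver using (solve-∀)
  open import Data.Nat.Tactic.RingSolver using () renaming (solve-∀ to solve-ℕ)
  open import Function.Bundles using (_⇔_; mk⇔)
  open Coefficients using (signedQ; Q-minus-≤; Q-minus->; Σ₁≡∑ℤ)
  open DistinctPartitions using (Q-mono; Q-positive; Q-strict)
  open AlternatingSums
  open Sign -1ℤ refl using (^-square)

  c : ℕ
  c = suc c′

  Q-minus-antitone : ∀ n {e e′} → e ≤ e′ → Qℤ (+ n - + e′) ≤ Qℤ (+ n - + e)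
  Q-minus-antitone n {e} {e′} e≤e′ with e′ ℕ.≤? n
  ... | no e′≰n  = ℕ.≤-trans (ℕ.≤-reflexive (Q-minus-> (ℕ.≰⇒> e′≰n))) z≤n
  ... | yes e′≤n = ≡.subst₂ _≤_ (≡.sym (Q-minus-≤ e′≤n)) (≡.sym (Q-minus-≤ (ℕ.≤-trans e≤e′ e′≤n)))
                     (Q-mono (ℕ.∸-monoʳ-≤ n e≤e′))

  Q-minus-strict : ∀ n {e e′} → e ≤ n → e ℕ.+ 3 ≤ e′ → Qℤ (+ n - + e′) < Qℤ (+ n - + e)
  Q-minus-strict n {e} {e′} e≤n e+3≤e′ with e′ ℕ.≤? n
  ... | no e′≰n  = ≡.subst₂ _<_ (≡.sym (Q-minus-> (ℕ.≰⇒> e′≰n))) (≡.sym (Q-minus-≤ e≤n)) (Q-positive (n ∸ e))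
  ... | yes e′≤n = ≡.subst₂ _<_ (≡.sym (Q-minus-≤ e′≤n)) (≡.sym (Q-minus-≤ e≤n))
      (≡.subst (λ x → Q (n ∸ e′) < Q x) n∸e′+[e′∸e]≡n∸e
        (Q-strict (n ∸ e′) (e′ ∸ e) (≡.subst (_≤ e′ ∸ e) (ℕ.m+n∸m≡n e 3) (ℕ.∸-monoˡ-≤ e e+3≤e′))))
    where
    e≤e′ : e ≤ e′
    e≤e′ = ℕ.≤-trans (ℕ.m≤m+n e 3) e+3≤e′
    n∸e′+[e′∸e]≡n∸e : n ∸ e′ ℕ.+ (e′ ∸ e) ≡ n ∸ e
    n∸e′+[e′∸e]≡n∸e = ≡.trans (≡.sym (ℕ.+-∸-assoc (n ∸ e′) e≤e′)) (cong (_∸ e) (ℕ.m∸n+n≡m e′≤n))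

  Σ₁-+ : ∀ k L g → Σ₁ (k ℕ.+ L) g ≡ Σ₁ k g + Σ₁ L (λ i → g (k ℕ.+ i))
  Σ₁-+ k zero    g = ≡.trans (cong (λ z → Σ₁ z g) (ℕ.+-identityʳ k)) (≡.sym (ℤ.+-identityʳ _))
  Σ₁-+ k (suc L) g = ≡.trans (cong (λ z → Σ₁ z g) (ℕ.+-suc k L))
    (≡.trans (cong₂ _+_ (Σ₁-+ k L g) (cong g (≡.sym (ℕ.+-suc k L)))) (ℤ.+-assoc (Σ₁ k g) _ _))

  -- The terms j = k+1, k+2, … of the sum, without their signs.
  tailQ : ℕ → ℕ → ℕ → ℕ
  tailQ n k t = Qℤ (+ n - + (c ℕ.* ((k ℕ.+ suc t) ℕ.* (k ℕ.+ suc t))))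

  tailQ-antitone : ∀ n k → Antitone (tailQ n k)
  tailQ-antitone n k t = Q-minus-antitone n (ℕ.*-monoʳ-≤ c (ℕ.*-mono-≤ k+1+t≤ k+1+t≤))
    where
    k+1+t≤ : k ℕ.+ suc t ≤ k ℕ.+ suc (suc t)
    k+1+t≤ = ℕ.+-monoʳ-≤ k (ℕ.n≤1+n (suc t))

  signedQ-tail : ∀ n k t → -1ℤ ^ k * -1ℤ * signedQ c n (k ℕ.+ suc t) ≡ -1ℤ ^ t * + tailQ n k t
  signedQ-tail n k t = begin
      σ * -1ℤ * (-1ℤ ^ (k ℕ.+ suc t) * + tailQ n k t)
    ≡⟨ cong (λ z → σ * -1ℤ * (z * + tailQ n k t)) (ℤ.^-distribˡ-+-* -1ℤ k (suc t)) ⟩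
      σ * -1ℤ * (σ * (-1ℤ * -1ℤ ^ t) * + tailQ n k t)
    ≡⟨ regroup σ (-1ℤ ^ t) (+ tailQ n k t) ⟩
      σ * σ * (-1ℤ ^ t * + tailQ n k t)
    ≡⟨ cong (_* (-1ℤ ^ t * + tailQ n k t)) (^-square k) ⟩
      + 1 * (-1ℤ ^ t * + tailQ n k t)
    ≡⟨ ℤ.*-identityˡ _ ⟩
      -1ℤ ^ t * + tailQ n k t
    ∎
    where
    open ≡.≡-Reasoning
    σ : ℤ
    σ = -1ℤ ^ k
    regroup : ∀ u v b → u * -1ℤ * (u * (-1ℤ * v) * b) ≡ u * u * (v * b)
    regroup = solve-∀

  expr≡alt : ∀ n k → 1 ≤ k → expr c ε n k ≡ + 2 * alt (suc n) (tailQ n k)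
  expr≡alt n k 1≤k = begin
      σ * (+ Q n + + 2 * S - ε n)
    ≡⟨ cong (λ z → σ * (+ Q n + + 2 * S - z)) (≡.sym ε≡) ⟩
      σ * (+ Q n + + 2 * S - (+ Q n + + 2 * (S + R)))
    ≡⟨ cancel σ (+ Q n) S R ⟩
      + 2 * (σ * -1ℤ * R)
    ≡⟨ cong (λ z → + 2 * (σ * -1ℤ * z)) (Σ₁≡∑ℤ (suc n) (g ∘ (k ℕ.+_))) ⟩
      + 2 * (σ * -1ℤ * ∑ℤ (suc n) (λ t → g (k ℕ.+ suc t)))
    ≡⟨ cong (+ 2 *_) (≡.trans (≡.sym (∑ℤ-*ˡ (suc n) (σ * -1ℤ) (λ t → g (k ℕ.+ suc t))))
                               (∑ℤ-cong (suc n) (λ t _ → signedQ-tail n k t))) ⟩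
      + 2 * alt (suc n) (tailQ n k)
    ∎
    where
    open ≡.≡-Reasoning
    σ : ℤ
    σ = -1ℤ ^ k
    g : ℕ → ℤ
    g = signedQ c n
    S R : ℤ
    S = Σ₁ k g
    R = Σ₁ (suc n) (g ∘ (k ℕ.+_))
    ε≡ : + Q n + + 2 * (S + R) ≡ ε n
    ε≡ = ≡.trans (cong (λ z → + Q n + + 2 * z) (≡.sym (≡.trans (cong (λ z → Σ₁ z g) 1+n+k≡k+1+n) (Σ₁-+ k (suc n) g))))
                 (identity n (n ℕ.+ k) (ℕ.m<m+n n 1≤k))
      where
      1+n+k≡k+1+n : suc (n ℕ.+ k) ≡ k ℕ.+ suc n
      1+n+k≡k+1+n = ≡.trans (cong suc (ℕ.+-comm n k)) (≡.sym (ℕ.+-suc k n))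
    cancel : ∀ u q s r → u * (q + + 2 * s - (q + + 2 * (s + r))) ≡ + 2 * (u * -1ℤ * r)
    cancel = solve-∀

  expr-nonnegative : ∀ n k → 1 ≤ k → + 0 ℤ.≤ expr c ε n k
  expr-nonnegative n k 1≤k = ≡.subst (+ 0 ℤ.≤_) (≡.sym (expr≡alt n k 1≤k))
    (ℤ.*-monoˡ-≤-nonNeg (+ 2) (proj₁ (alt-bounds (suc n) (tailQ n k) (tailQ-antitone n k))))

  -- The first two tail exponents differ by c (2k + 3) ≥ 3.
  expr-positive : ∀ n k → 1 ≤ k → c ℕ.* (suc k ℕ.* suc k) ≤ n → + 0 ℤ.< expr c ε n k
  expr-positive n k 1≤k e₀≤n = ≡.subst (+ 0 ℤ.<_) (≡.sym (expr≡alt n k 1≤k))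
    (ℤ.*-monoˡ-<-pos (+ 2) (ℤ.<-≤-trans 0<B₀-B₁ (alt-≥-difference n (tailQ n k) (tailQ-antitone n k))))
    where
    e : ℕ → ℕ
    e t = c ℕ.* ((k ℕ.+ suc t) ℕ.* (k ℕ.+ suc t))
    e₀≡ : c ℕ.* (suc k ℕ.* suc k) ≡ e 0
    e₀≡ = cong (λ x → c ℕ.* (x ℕ.* x)) (ℕ.+-comm 1 k)
    e₀+3≤e₁ : e 0 ℕ.+ 3 ≤ e 1
    e₀+3≤e₁ = ≡.subst (e 0 ℕ.+ 3 ≤_) (≡.sym (gap c′ k))
      (ℕ.+-monoʳ-≤ (e 0) (ℕ.≤-trans (ℕ.m≤n+m 3 (k ℕ.+ k)) (ℕ.m≤n*m (k ℕ.+ k ℕ.+ 3) c)))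
      where
      gap : ∀ c′ k → suc c′ ℕ.* ((k ℕ.+ 2) ℕ.* (k ℕ.+ 2))
                     ≡ suc c′ ℕ.* ((k ℕ.+ 1) ℕ.* (k ℕ.+ 1)) ℕ.+ suc c′ ℕ.* (k ℕ.+ k ℕ.+ 3)
      gap = solve-ℕ
    B₁<B₀ : tailQ n k 1 < tailQ n k 0
    B₁<B₀ = Q-minus-strict n (≡.subst (_≤ n) e₀≡ e₀≤n) e₀+3≤e₁
    0<B₀-B₁ : + 0 ℤ.< + tailQ n k 0 - + tailQ n k 1
    0<B₀-B₁ = ≡.subst (+ 0 ℤ.<_)
                (≡.sym (≡.trans (ℤ.m-n≡m⊖n (tailQ n k 0) (tailQ n k 1)) (ℤ.⊖-≥ (ℕ.<⇒≤ B₁<B₀))))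
                      (ℤ.+<+ (ℕ.m<n⇒0<n∸m B₁<B₀))

  expr-zero : ∀ n k → 1 ≤ k → n < c ℕ.* (suc k ℕ.* suc k) → expr c ε n k ≡ + 0
  expr-zero n k 1≤k n<e₀ = ≡.trans (expr≡alt n k 1≤k)
    (cong (+ 2 *_) (alt-zero (suc n) (tailQ n k) (λ t → Q-minus-> (ℕ.<-≤-trans n<e₀ (e₀≤ t)))))
    where
    e₀≤ : ∀ t → c ℕ.* (suc k ℕ.* suc k) ≤ c ℕ.* ((k ℕ.+ suc t) ℕ.* (k ℕ.+ suc t))
    e₀≤ t = ℕ.*-monoʳ-≤ c (ℕ.*-mono-≤ k+1≤ k+1≤)
      where
      k+1≤ : suc k ≤ k ℕ.+ suc t
      k+1≤ = ≡.subst (_≤ k ℕ.+ suc t) (ℕ.+-comm k 1) (ℕ.+-monoʳ-≤ k (s≤s z≤n))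

  expr-sign : ∀ n k → 1 ≤ k →
    (+ 0 ℤ.≤ expr c ε n k) × ((+ 0 ℤ.< expr c ε n k) ⇔ (c ℕ.* (suc k ℕ.* suc k) ≤ n))
  expr-sign n k 1≤k = expr-nonnegative n k 1≤k , mk⇔ positive⇒ (expr-positive n k 1≤k)
    where
    positive⇒ : + 0 ℤ.< expr c ε n k → c ℕ.* (suc k ℕ.* suc k) ≤ n
    positive⇒ 0<expr with c ℕ.* (suc k ℕ.* suc k) ℕ.≤? n
    ... | yes e₀≤n = e₀≤n
    ... | no e₀≰n  = ⊥-elim (ℤ.<-irrefl (≡.sym (expr-zero n k 1≤k (ℕ.≰⇒> e₀≰n))) 0<expr)

open import Data.Integer using (_≤_; _<_)
open import Data.Nat using (_*_) renaming (_≤_ to _≤ℕ_)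
open import Function.Bundles using (_⇔_; mk⇔; Equivalence)

corollary1p5 : (n k : ℕ) → 1 ≤ℕ k →
    ((+ 0 ≤ expr 1 ε₁ n k) × ((+ 0 < expr 1 ε₁ n k) ⇔ (suc k * suc k ≤ℕ n)))
    × ((+ 0 ≤ expr 2 ε₂ n k) × ((+ 0 < expr 2 ε₂ n k) ⇔ (2 * (suc k * suc k) ≤ℕ n)))
    × ((+ 0 ≤ expr 3 ε₃ n k) × ((+ 0 < expr 3 ε₃ n k) ⇔ (3 * (suc k * suc k) ≤ℕ n)))
corollary1p5 n k 1≤k =
  (proj₁ part₁ , mk⇔ (≡.subst (_≤ℕ n) 1*e≡e ∘ to (proj₂ part₁))
                     (from (proj₂ part₁) ∘ ≡.subst (_≤ℕ n) (≡.sym 1*e≡e))) ,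
  Inequality.expr-sign 1 ε₂ Q-identity₂ n k 1≤k ,
  Inequality.expr-sign 2 ε₃ Q-identity₃ n k 1≤k
  where
  open Coefficients using (Q-identity₁; Q-identity₂; Q-identity₃)
  open Equivalence using (to; from)
  part₁ : (+ 0 ≤ expr 1 ε₁ n k) × ((+ 0 < expr 1 ε₁ n k) ⇔ (1 * (suc k * suc k) ≤ℕ n))
  part₁ = Inequality.expr-sign 0 ε₁ Q-identity₁ n k 1≤k
  1*e≡e : 1 * (suc k * suc k) ≡ suc k * suc k
  1*e≡e = ℕ.*-identityˡ (suc k * suc k)
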